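{- Let $n\ge1$ and let $a_{ij}$ ($i=0,\dots,n$, $j=1,\dots,n$) be positive integers with $a_{0j}\le\dots\le a_{n-1,j}$ for every $j$; let $\mathcal{A}_i=\{b\in\mathbb{Z}^n:0\le b_j\le a_{ij}\}$ with $S(\rho)$, $\mathcal{B}$, $t_b$, $i(b)$, $a(b)$, $\varphi_b$, $\mathcal{G}$, $I_b$, $g_b$ as in the context. Let $b\in\mathcal{G}$ with $g_b=K>0$. Then there is $b'\in\mathcal{G}$ with $g_{b'}=K-1$ such that for some $\overline{b}\in b'-a(b')+\mathcal{A}_{i(b')}$ one has $\varphi_{\overline{b}}=\varphi_b$; moreover $b$ is reached from $b'$, i.e. there exist $c_0=b',c_1,\dots,c_m=b$ in $\mathcal{B}$ with $c_{k+1}\in c_k-a(c_k)+\mathcal{A}_{i(c_k)}$ for all $k$.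
   Context: $\Delta_i=\mathrm{conv}(\mathcal{A}_i)$, $\Delta=\sum_i\Delta_i$. Fix $v\in\mathbb{R}^n$ with all $v_j<0$ and sufficiently small reals $\lambda_0>\dots>\lambda_n\ge0$; the lifting $\omega_i(x)=\lambda_i\langle v,x\rangle$ on $\mathcal{A}_i$ induces a coherent mixed subdivision $S(\rho)$ of $\Delta$ whose cells have components $D=D_0+\dots+D_n$. Fix $\delta\in\mathbb{R}^n$ with all coordinates negative and sufficiently small (generic), $\mathcal{B}=(\Delta+\delta)\cap\mathbb{Z}^n$. For $b\in\mathcal{B}$ in a translated $n$-cell $D+\delta$: $t_{b,i}=\dim D_i$, $i(b)=\max\{i:t_{b,i}=0\}$, $a(b)$ the point $D_{i(b)}$. $b$ lies in a mixed cell if exactly one $t_{b,i}$ is $0$, otherwise in a non-mixed cell. The type function $\varphi_b:\{1,\dots,n\}\to\{0,\dots,n\}$ is given by $\sum_{k=0}^{\varphi_b(j)-1}a_{kj}\le b_j<\sum_{k=0}^{\varphi_b(j)}a_{kj}$. $\mathcal{G}=\{b\in\mathcal{B}:\sum_{i=0}^It_{b,i}\le I+1\ \forall I<n\}$. $I_b=\max\{i:t_{b,i}\ge2\}$ if $b$ lies in a non-mixed cell and $I_b=0$ if $b$ lies in a mixed cell; $g_b=|\{i<I_b: t_{b,i}=0\}|$. -}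

module Defs where

open import Data.Nat using (ℕ; zero; suc; _+_; _≤_; _<_; _<ᵇ_; _≡ᵇ_)
open import Data.Bool using (Bool; true; false; if_then_else_)
open import Data.Fin using (Fin; toℕ)
open import Data.List using (List; []; _∷_; map)
open import Data.Nat.ListAction using (sum)
open import Data.List.Base using (allFin)
open import Data.Product using (_×_)

-- Data: a i j = a_{ij} for i = 0..n (Fin (suc n)) and j = 1..n (Fin n, shifted by one).
Coeffs : ℕ → Set
Coeffs n = Fin (suc n) → Fin n → ℕ

-- Points of Z^n with nonnegative coordinates (all points of B are such).
Pt : ℕ → Set
Pt n = Fin n → ℕ

-- Type of a cell of the mixed subdivision S(ρ): a function k : {1..n} → {0..n}.
CellIx : ℕ → Set
CellIx n = Fin n → Fin (suc n)

count : {A : Set} → (A → Bool) → List A → ℕ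
count p [] = 0
count p (x ∷ xs) = if p x then suc (count p xs) else count p xs

finEq : {m : ℕ} → Fin m → Fin m → Bool
finEq i j = toℕ i ≡ᵇ toℕ j

prefix : {n : ℕ} → Coeffs n → ℕ → Fin n → ℕ
prefix {n} a m j = sum (map (λ k → a k j) (Data.List.filterᵇ (λ k → toℕ k <ᵇ m) (allFin (suc n))))
  where import Data.List

HasType : {n : ℕ} → Coeffs n → Pt n → CellIx n → Set
HasType a b φ = ∀ j → (prefix a (toℕ (φ j)) j ≤ b j) × (b j < prefix a (suc (toℕ (φ j))) j)

-- Components of the n-cell D = D_0 + ... + D_n of S(ρ) indexed by φ:
-- coordinate j of D_i is the point a_{ij} if φ(j) > i, the segment [0,a_{ij}] if φ(j) = i,
-- and the point 0 if φ(j) < i.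
data Seg : Set where
  point    : ℕ → Seg
  interval : ℕ → ℕ → Seg

comp : {n : ℕ} → Coeffs n → CellIx n → Fin (suc n) → Fin n → Seg
comp a φ i j =
  if toℕ i <ᵇ toℕ (φ j) then point (a i j)
  else (if finEq (φ j) i then interval 0 (a i j) else point 0)

isInterval : Seg → Bool
isInterval (point _) = false
isInterval (interval _ _) = true

segPoint : Seg → ℕ
segPoint (point x) = x
segPoint (interval x _) = x

t : {n : ℕ} → Coeffs n → CellIx n → Fin (suc n) → ℕ
t {n} a φ i = count (λ j → isInterval (comp a φ i j)) (allFin n)

isZ : ℕ → Bool
isZ m = m ≡ᵇ 0

lastSat : {m : ℕ} → (Fin m → Bool) → List (Fin m) → Fin m → Fin m
lastSat p [] d = d
lastSat p (i ∷ is) d = lastSat p is (if p i then i else d)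

-- i(b) = max{ i : t_{b,i} = 0 }  (such i always exists since Σ_i t_{b,i} = n < n+1)
iOf : {n : ℕ} → Coeffs n → CellIx n → Fin (suc n)
iOf {n} a φ = lastSat (λ i → isZ (t a φ i)) (allFin (suc n)) Fin.zero
  where import Data.Fin as Fin

aOf : {n : ℕ} → Coeffs n → CellIx n → Pt n
aOf a φ j = segPoint (comp a φ (iOf a φ) j)

mixed : {n : ℕ} → Coeffs n → CellIx n → Bool
mixed {n} a φ = count (λ i → isZ (t a φ i)) (allFin (suc n)) ≡ᵇ 1

Ib : {n : ℕ} → Coeffs n → CellIx n → ℕ
Ib {n} a φ =
  if mixed a φ then 0
  else toℕ (lastSat (λ i → 1 <ᵇ t a φ i) (allFin (suc n)) Fin.zero)
  where import Data.Fin as Fin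

gOf : {n : ℕ} → Coeffs n → CellIx n → ℕ
gOf {n} a φ = count (λ i → (toℕ i <ᵇ Ib a φ) Data.Bool.∧ isZ (t a φ i)) (allFin (suc n))
  where import Data.Bool

InG : {n : ℕ} → Coeffs n → CellIx n → Set
InG {n} a φ = ∀ (I : Fin (suc n)) → toℕ I < n →
  sum (map (t a φ) (Data.List.filterᵇ (λ i → toℕ i <ᵇ suc (toℕ I)) (allFin (suc n)))) ≤ suc (toℕ I)
  where import Data.List

Step : {n : ℕ} → Coeffs n → Pt n → CellIx n → Pt n → Set
Step a c φc c' = ∀ j →
  (c j ≤ c' j + aOf a φc j) × (c' j + aOf a φc j ≤ c j + a (iOf a φc) j)

data Reach {n : ℕ} (a : Coeffs n) : Pt n → Pt n → Set where
  done : ∀ {c} → Reach a c c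
  step : ∀ {c c' d} (φc : CellIx n) → HasType a c φc → Step a c φc c' → Reach a c' d → Reach a c d

-- Everything in the statement depends on the cell of b only through its level
-- profile t_k = dim φ k (k = 0, …, n), which sums to n: i(b) is the last empty
-- level, I_b the last crowded one (t_k ≥ 2; a mixed cell has none, and then
-- I_b = 0), g_b counts the empty levels below I_b, and b ∈ G bounds the partial
-- sums by t_0 + … + t_J ≤ J + 1.  The point b' lowers some coordinates of b by
-- one level so that the profile loses exactly one empty level below I_b.
--
-- If z = i(b) < I_b, all levels above z move down, so z disappears and level n
-- becomes empty.  The chain from b' back to b restores the levels n, n-1, …, z+1
-- one per step: when level p is restored it is the last empty level of the
-- current cell, so i = p and its coordinates may rise by a_{pj}, back into
-- their slab in b.
--
-- If I_b < z, let q be the last crowded level below I_b (or I_b itself if there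
-- is none) and z₂ < q the last empty level below q, which exists because b ∈ G.
-- The levels strictly between z₂ and q move down together with one coordinate
-- of level q.  Level I_b stays crowded unless q = I_b and t_q = 2, and then the
-- new cell is mixed and g_b = 1.  All moved coordinates lie below i(b) = z, so
-- b is reached from b' by one step to the bottoms of their original slabs and
-- then by unit steps inside the cell of b.

module Submission where

open import Defs
import Data.Bool
open import Data.Bool using (Bool; true; false; if_then_else_; _∧_; not)
open import Data.Bool.Properties using (if-float)
open import Data.Empty using (⊥-elim)
open import Data.Fin as Fin using (Fin; toℕ; fromℕ<)
open import Data.Fin.Properties using (toℕ-inject₁; toℕ<n; toℕ-fromℕ<; fromℕ<-toℕ; toℕ-injective)
import Data.List
open import Data.List using ([]; _∷_; _++_; map; foldl; upTo; allFin; tabulate; filterᵇ)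
open import Data.List.Membership.Propositional using (_∈_)
open import Data.List.Membership.Propositional.Properties using (∈-allFin)
open import Data.List.Relation.Unary.Any using (here; there)
open import Data.List.Properties using (length-tabulate; map-++; foldl-∷ʳ; upTo-∷ʳ; map-tabulate; map-cong; map-∘)
open import Data.Nat
open import Data.Nat.ListAction using (sum)
open import Data.Nat.ListAction.Properties using (sum-++)
open import Data.Nat.Properties
open import Relation.Binary.Definitions using (tri<; tri≈; tri>)
open import Algebra.Properties.CommutativeSemigroup +-commutativeSemigroup
  using (xy∙z≈xz∙y; interchange)
open import Data.Product using (Σ; ∃; ∃₂; ∃-syntax; _×_; _,_; proj₁; proj₂)
open import Data.Sum using (_⊎_; inj₁; inj₂; [_,_])
open import Function using (id; _∘_; _⇔_; mk⇔)
open import Function.Bundles using (Equivalence)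
open import Level using (Level)
open import Relation.Binary.PropositionalEquality hiding ([_])
open import Relation.Nullary using (¬_; Dec; yes; no; does; contradiction)
open import Relation.Nullary.Reflects using (ofʸ)
open import Relation.Nullary.Decidable using (dec-true; dec-false; does-⇔; _×-dec_; _⊎-dec_; ¬?)
open import Relation.Unary using (Pred; Decidable)

private
  variable
    ℓ : Level
    P : Pred ℕ ℓ

-- Sums and last indices over initial segments of ℕ

sumBelow : (ℕ → ℕ) → ℕ → ℕ
sumBelow f zero = 0
sumBelow f (suc m) = sumBelow f m + f m

module _ {f g : ℕ → ℕ} where

  sumBelow-cong : ∀ m → (∀ {k} → k < m → f k ≡ g k) → sumBelow f m ≡ sumBelow g m
  sumBelow-cong zero _ = refl
  sumBelow-cong (suc m) f≗g = cong₂ _+_ (sumBelow-cong m (f≗g ∘ m<n⇒m<1+n)) (f≗g (n<1+n m))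

  sumBelow-extend : ∀ {c m} → c ≤ m → sumBelow f c ≡ sumBelow g c →
    (∀ {k} → c ≤ k → k < m → f k ≡ g k) → sumBelow f m ≡ sumBelow g m
  sumBelow-extend {c} {m} c≤m eq f≗g with m≤n⇒m<n∨m≡n c≤m
  ... | inj₂ refl = eq
  sumBelow-extend {c} {suc m} _ eq f≗g | inj₁ c<sm =
    cong₂ _+_ (sumBelow-extend (s≤s⁻¹ c<sm) eq (λ c≤k → f≗g c≤k ∘ m<n⇒m<1+n)) (f≗g (s≤s⁻¹ c<sm) (n<1+n m))

  sumBelow-delete : ∀ {x p m} → (∀ {k} → k < x → g k ≡ f k) → (∀ {k} → x ≤ k → k < p → g k ≡ f (suc k)) →
    x ≤ m → m ≤ p → sumBelow f (suc m) ≡ sumBelow g m + f x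
  sumBelow-delete {x} {p} {m} below above x≤m m≤p with m≤n⇒m<n∨m≡n x≤m
  ... | inj₂ refl = cong (_+ f x) (sumBelow-cong x (sym ∘ below))
  sumBelow-delete {x} {p} {suc m} below above _ m<p | inj₁ x<m = begin
    sumBelow f (suc m) + f (suc m)  ≡⟨ cong₂ _+_ (sumBelow-delete below above (s≤s⁻¹ x<m) (<⇒≤ m<p))
                                                   (sym (above (s≤s⁻¹ x<m) m<p)) ⟩
    sumBelow g m + f x + g m        ≡⟨ xy∙z≈xz∙y _ (f x) (g m) ⟩
    sumBelow g m + g m + f x        ∎
    where open ≡-Reasoning

  sumBelow-update : ∀ {x m} → x < m → (∀ {k} → k < m → k ≢ x → f k ≡ g k) →
    sumBelow f m + g x ≡ sumBelow g m + f x
  sumBelow-update {x} {suc m} x<m f≗g with m ≟ x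
  ... | yes refl = begin
    sumBelow f m + f m + g m  ≡⟨ cong (λ s → s + f m + g m) (sumBelow-cong m (λ k<m → f≗g (m<n⇒m<1+n k<m) (<⇒≢ k<m))) ⟩
    sumBelow g m + f m + g m  ≡⟨ xy∙z≈xz∙y _ (f m) (g m) ⟩
    sumBelow g m + g m + f m  ∎
    where open ≡-Reasoning
  ... | no m≢x = begin
    sumBelow f m + f m + g x  ≡⟨ xy∙z≈xz∙y _ (f m) (g x) ⟩
    sumBelow f m + g x + f m  ≡⟨ cong₂ _+_ (sumBelow-update (≤∧≢⇒< (s≤s⁻¹ x<m) (m≢x ∘ sym)) (f≗g ∘ m<n⇒m<1+n))
                                           (f≗g (n<1+n m) m≢x) ⟩
    sumBelow g m + f x + g m  ≡⟨ xy∙z≈xz∙y _ (f x) (g m) ⟩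
    sumBelow g m + g m + f x  ∎
    where open ≡-Reasoning

module _ {f : ℕ → ℕ} where

  sumBelow-mono : ∀ {m m'} → m ≤ m' → sumBelow f m ≤ sumBelow f m'
  sumBelow-mono {m} {m'} m≤m' with m≤n⇒m<n∨m≡n m≤m'
  ... | inj₂ refl = ≤-refl
  sumBelow-mono {m} {suc m'} _ | inj₁ m<sm' = ≤-trans (sumBelow-mono (s≤s⁻¹ m<sm')) (m≤m+n _ (f m'))

  ≤-sumBelow : ∀ {k m} → k < m → f k ≤ sumBelow f m
  ≤-sumBelow {k} k<m = ≤-trans (m≤n+m (f k) _) (sumBelow-mono k<m)

  sumBelow-∃ : ∀ m → 0 < sumBelow f m → ∃[ k ] k < m × 0 < f k
  sumBelow-∃ (suc m) pos with 0 <? f m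
  ... | yes fm>0 = m , n<1+n m , fm>0
  ... | no fm≯0 = let k , k<m , fk = sumBelow-∃ m below in k , m<n⇒m<1+n k<m , fk
    where
    below : 0 < sumBelow f m
    below = subst (0 <_) (+-identityʳ _) (≤-trans pos (+-monoʳ-≤ (sumBelow f m) (≮⇒≥ fm≯0)))

  sumBelow-zeroFrom : ∀ {c m} → c ≤ m → (∀ {k} → c ≤ k → k < m → f k ≡ 0) → sumBelow f m ≡ sumBelow f c
  sumBelow-zeroFrom {c} {m} c≤m zero-above with m≤n⇒m<n∨m≡n c≤m
  ... | inj₂ refl = refl
  sumBelow-zeroFrom {c} {suc m} _ zero-above | inj₁ c<sm = begin
    sumBelow f m + f m  ≡⟨ cong (sumBelow f m +_) (zero-above (s≤s⁻¹ c<sm) (n<1+n m)) ⟩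
    sumBelow f m + 0    ≡⟨ +-identityʳ _ ⟩
    sumBelow f m        ≡⟨ sumBelow-zeroFrom (s≤s⁻¹ c<sm) (λ c≤k → zero-above c≤k ∘ m<n⇒m<1+n) ⟩
    sumBelow f c        ∎
    where open ≡-Reasoning

  sumBelow-lowerBound : ∀ {a b} → a ≤ b → (∀ {k} → a ≤ k → k < b → 1 ≤ f k) →
    sumBelow f a + (b ∸ a) ≤ sumBelow f b
  sumBelow-lowerBound {a} {b} a≤b pos with m≤n⇒m<n∨m≡n a≤b
  ... | inj₂ refl = ≤-reflexive (trans (cong (sumBelow f a +_) (n∸n≡0 a)) (+-identityʳ _))
  sumBelow-lowerBound {a} {suc b} _ pos | inj₁ a<sb = begin
    sumBelow f a + (suc b ∸ a)      ≡⟨ cong (sumBelow f a +_) (+-∸-assoc 1 (s≤s⁻¹ a<sb)) ⟩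
    sumBelow f a + suc (b ∸ a)      ≡⟨ +-suc _ _ ⟩
    suc (sumBelow f a + (b ∸ a))    ≡⟨ +-comm 1 _ ⟩
    sumBelow f a + (b ∸ a) + 1      ≤⟨ +-mono-≤ (sumBelow-lowerBound (s≤s⁻¹ a<sb) (λ a≤k → pos a≤k ∘ m<n⇒m<1+n))
                                                (pos (s≤s⁻¹ a<sb) (n<1+n b)) ⟩
    sumBelow f b + f b              ∎
    where open ≤-Reasoning

  sumBelow-zero : ∀ m → (∀ {k} → k < m → f k ≡ 0) → sumBelow f m ≡ 0
  sumBelow-zero m zero-below = sumBelow-zeroFrom z≤n (λ _ → zero-below)

lastBelow : {P : Pred ℕ ℓ} → Decidable P → ℕ → ℕ → ℕ
lastBelow P? zero d = d
lastBelow P? (suc m) d = if does (P? m) then m else lastBelow P? m d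

data LastBelow (P : Pred ℕ ℓ) (m d : ℕ) : ℕ → Set ℓ where
  none  : (∀ {k} → k < m → ¬ P k) → LastBelow P m d d
  found : ∀ {l} → l < m → P l → (∀ {k} → l < k → k < m → ¬ P k) → LastBelow P m d l

lastBelow-view : (P? : Decidable P) (m d : ℕ) → LastBelow P m d (lastBelow P? m d)
lastBelow-view P? zero d = none (λ ())
lastBelow-view P? (suc m) d with P? m
... | yes p = found (n<1+n m) p (λ m<k k<sm → contradiction (s≤s⁻¹ k<sm) (<⇒≱ m<k))
... | no ¬p with lastBelow P? m d | lastBelow-view P? m d
...   | _ | none ¬P = none (λ k<sm → [ ¬P , (λ { refl → ¬p }) ] (m≤n⇒m<n∨m≡n (s≤s⁻¹ k<sm)))
...   | _ | found l<m pl ¬P = found (m<n⇒m<1+n l<m) pl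
          (λ l<k k<sm → [ ¬P l<k , (λ { refl → ¬p }) ] (m≤n⇒m<n∨m≡n (s≤s⁻¹ k<sm)))

LastBelow-functional : ∀ {P : Pred ℕ ℓ} {m d l l'} → LastBelow P m d l → LastBelow P m d l' → l ≡ l'
LastBelow-functional (none _) (none _) = refl
LastBelow-functional (none ¬P) (found l'<m pl' _) = contradiction pl' (¬P l'<m)
LastBelow-functional (found l<m pl _) (none ¬P) = contradiction pl (¬P l<m)
LastBelow-functional {l = l} {l'} (found l<m pl ¬P) (found l'<m pl' ¬P') with <-cmp l l'
... | tri< l<l' _ _ = contradiction pl' (¬P l<l' l'<m)
... | tri≈ _ l≡l' _ = l≡l'
... | tri> _ _ l'<l = contradiction pl (¬P' l'<l l<m)

isZero : ℕ → ℕ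
isZero zero = 1
isZero (suc _) = 0

isZero-≢0 : ∀ {m} → m ≢ 0 → isZero m ≡ 0
isZero-≢0 {zero} m≢0 = contradiction refl m≢0
isZero-≢0 {suc m} _ = refl

zerosBelow : (ℕ → ℕ) → ℕ → ℕ
zerosBelow T = sumBelow (isZero ∘ T)

module _ (T : ℕ → ℕ) where

  sumBelow-+-zerosBelow : ∀ m → sumBelow T m + zerosBelow T m ≡ m + sumBelow (pred ∘ T) m
  sumBelow-+-zerosBelow zero = refl
  sumBelow-+-zerosBelow (suc m) = begin
    sumBelow T m + T m + (zerosBelow T m + isZero (T m))
      ≡⟨ interchange (sumBelow T m) (T m) (zerosBelow T m) (isZero (T m)) ⟩
    sumBelow T m + zerosBelow T m + (T m + isZero (T m))      ≡⟨ cong₂ _+_ (sumBelow-+-zerosBelow m) (m+isZero≡1+pred (T m)) ⟩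
    m + sumBelow (pred ∘ T) m + suc (pred (T m))              ≡⟨ +-suc _ _ ⟩
    suc (m + sumBelow (pred ∘ T) m + pred (T m))              ≡⟨ cong suc (+-assoc m _ _) ⟩
    suc m + sumBelow (pred ∘ T) (suc m)                       ∎
    where
    open ≡-Reasoning
    m+isZero≡1+pred : ∀ x → x + isZero x ≡ suc (pred x)
    m+isZero≡1+pred zero = refl
    m+isZero≡1+pred (suc x) = +-identityʳ (suc x)

  crowded⇒sumBelow-+-zerosBelow : ∀ {k m} → k < m → 1 < T k → m < sumBelow T m + zerosBelow T m
  crowded⇒sumBelow-+-zerosBelow {k} {m} k<m crowded = begin-strict
    m                              ≡⟨ +-identityʳ m ⟨
    m + 0                          <⟨ +-monoʳ-< m (≤-trans (pred-mono-≤ crowded) (≤-sumBelow {f = pred ∘ T} k<m)) ⟩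
    m + sumBelow (pred ∘ T) m      ≡⟨ sumBelow-+-zerosBelow m ⟨
    sumBelow T m + zerosBelow T m  ∎
    where open ≤-Reasoning

  flat⇒sumBelow-+-zerosBelow : ∀ {m} → (∀ {k} → k < m → ¬ 1 < T k) → sumBelow T m + zerosBelow T m ≡ m
  flat⇒sumBelow-+-zerosBelow {m} flat = begin
    sumBelow T m + zerosBelow T m  ≡⟨ sumBelow-+-zerosBelow m ⟩
    m + sumBelow (pred ∘ T) m      ≡⟨ cong (m +_) (sumBelow-zero m (λ k<m → n≤0⇒n≡0 (pred-mono-≤ (≮⇒≥ (flat k<m))))) ⟩
    m + 0                          ≡⟨ +-identityʳ m ⟩
    m                              ∎
    where open ≡-Reasoning

-- Sums and counts over allFin

tabulate-toℕ : ∀ {a} {A : Set a} (f : ℕ → A) m → tabulate {n = m} (f ∘ toℕ) ≡ Data.List.applyUpTo f m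
tabulate-toℕ f zero = refl
tabulate-toℕ f (suc m) = cong (f 0 ∷_) (tabulate-toℕ (f ∘ suc) m)

map-toℕ-allFin : ∀ m → map toℕ (allFin m) ≡ upTo m
map-toℕ-allFin m = trans (map-tabulate {n = m} id toℕ) (tabulate-toℕ id m)

sum-upTo : ∀ h m → sum (map h (upTo m)) ≡ sumBelow h m
sum-upTo h zero = refl
sum-upTo h (suc m) = begin
  sum (map h (upTo (suc m)))           ≡⟨ cong (sum ∘ map h) (sym (upTo-∷ʳ m)) ⟩
  sum (map h (upTo m ++ m ∷ []))       ≡⟨ cong sum (map-++ h (upTo m) (m ∷ [])) ⟩
  sum (map h (upTo m) ++ h m ∷ [])     ≡⟨ sum-++ (map h (upTo m)) (h m ∷ []) ⟩
  sum (map h (upTo m)) + (h m + 0)     ≡⟨ cong₂ _+_ (sum-upTo h m) (+-identityʳ (h m)) ⟩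
  sumBelow h m + h m                   ∎
  where open ≡-Reasoning

sum-allFin : ∀ {m} (g : Fin m → ℕ) (h : ℕ → ℕ) → (∀ i → g i ≡ h (toℕ i)) →
  sum (map g (allFin m)) ≡ sumBelow h m
sum-allFin {m} g h g≗h = begin
  sum (map g (allFin m))             ≡⟨ cong sum (map-cong g≗h (allFin m)) ⟩
  sum (map (h ∘ toℕ) (allFin m))     ≡⟨ cong sum (map-∘ (allFin m)) ⟩
  sum (map h (map toℕ (allFin m)))   ≡⟨ cong (sum ∘ map h) (map-toℕ-allFin m) ⟩
  sum (map h (upTo m))               ≡⟨ sum-upTo h m ⟩
  sumBelow h m                       ∎
  where open ≡-Reasoning

count-as-sum : ∀ {A : Set} (p : A → Bool) xs → count p xs ≡ sum (map (λ x → if p x then 1 else 0) xs)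
count-as-sum p [] = refl
count-as-sum p (x ∷ xs) with p x
... | true = cong suc (count-as-sum p xs)
... | false = count-as-sum p xs

sum-filterᵇ : ∀ {A : Set} (g : A → ℕ) (p : A → Bool) xs →
  sum (map g (filterᵇ p xs)) ≡ sum (map (λ x → if p x then g x else 0) xs)
sum-filterᵇ g p [] = refl
sum-filterᵇ g p (x ∷ xs) with p x
... | true = cong (g x +_) (sum-filterᵇ g p xs)
... | false = sum-filterᵇ g p xs

sumBelow-restrict : ∀ f {c m} → c ≤ m → sumBelow (λ k → if k <ᵇ c then f k else 0) m ≡ sumBelow f c
sumBelow-restrict f {c} c≤m = trans
  (sumBelow-zeroFrom c≤m (λ {k} c≤k _ → cong (if_then f k else 0) (dec-false (k <? c) (≤⇒≯ c≤k))))
  (sumBelow-cong c (λ {k} k<c → cong (if_then f k else 0) (dec-true (k <? c) k<c)))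

sum-filter-allFin : ∀ {N} (g : Fin N → ℕ) (h : ℕ → ℕ) → (∀ i → g i ≡ h (toℕ i)) → ∀ {c} → c ≤ N →
  sum (map g (filterᵇ (λ i → toℕ i <ᵇ c) (allFin N))) ≡ sumBelow h c
sum-filter-allFin {N} g h g≗h {c} c≤N = begin
  sum (map g (filterᵇ (λ i → toℕ i <ᵇ c) (allFin N)))
    ≡⟨ sum-filterᵇ g _ (allFin N) ⟩
  sum (map (λ i → if toℕ i <ᵇ c then g i else 0) (allFin N))
    ≡⟨ sum-allFin _ (λ k → if k <ᵇ c then h k else 0) (λ i → cong (if toℕ i <ᵇ c then_else 0) (g≗h i)) ⟩
  sumBelow (λ k → if k <ᵇ c then h k else 0) N
    ≡⟨ sumBelow-restrict h c≤N ⟩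
  sumBelow h c
    ∎
  where open ≡-Reasoning

module _ {P : Pred ℕ ℓ} (P? : Decidable P) where

  private
    lastStep : ℕ → ℕ → ℕ
    lastStep l k = if does (P? k) then k else l

    toℕ-lastSat : ∀ {m} {p : Fin m → Bool} → (∀ i → p i ≡ does (P? (toℕ i))) →
      ∀ xs d → toℕ (lastSat p xs d) ≡ foldl lastStep (toℕ d) (map toℕ xs)
    toℕ-lastSat p≗P [] d = refl
    toℕ-lastSat {p = p} p≗P (x ∷ xs) d = trans (toℕ-lastSat p≗P xs _)
      (cong (λ l → foldl lastStep l (map toℕ xs))
            (trans (if-float toℕ (p x)) (cong (if_then toℕ x else toℕ d) (p≗P x))))

    foldl-upTo : ∀ m l → foldl lastStep l (upTo m) ≡ lastBelow P? m l
    foldl-upTo zero l = refl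
    foldl-upTo (suc m) l = begin
      foldl lastStep l (upTo (suc m))         ≡⟨ cong (foldl lastStep l) (sym (upTo-∷ʳ m)) ⟩
      foldl lastStep l (upTo m ++ m ∷ [])     ≡⟨ foldl-∷ʳ lastStep l m (upTo m) ⟩
      lastStep (foldl lastStep l (upTo m)) m  ≡⟨ cong (λ l' → lastStep l' m) (foldl-upTo m l) ⟩
      lastStep (lastBelow P? m l) m           ∎
      where open ≡-Reasoning

  lastSat-allFin : ∀ {m} {p : Fin m → Bool} → (∀ i → p i ≡ does (P? (toℕ i))) →
    ∀ d → toℕ (lastSat p (allFin m) d) ≡ lastBelow P? m (toℕ d)
  lastSat-allFin {m} p≗P d = trans (toℕ-lastSat p≗P (allFin m) d)
    (trans (cong (foldl lastStep (toℕ d)) (map-toℕ-allFin m)) (foldl-upTo m (toℕ d)))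

count-cong : ∀ {A : Set} {p q : A → Bool} → (∀ x → p x ≡ q x) → ∀ xs → count p xs ≡ count q xs
count-cong p≗q [] = refl
count-cong {p = p} {q} p≗q (x ∷ xs) rewrite p≗q x with q x
... | true = cong suc (count-cong p≗q xs)
... | false = count-cong p≗q xs

module _ {n : ℕ} where

  countFin : {P : Pred (Fin n) ℓ} → Decidable P → ℕ
  countFin P? = count (does ∘ P?) (allFin n)

  module _ {ℓ' : Level} {P : Pred (Fin n) ℓ} {Q : Pred (Fin n) ℓ'} (P? : Decidable P) (Q? : Decidable Q) where

    countFin-cong : (∀ j → P j ⇔ Q j) → countFin P? ≡ countFin Q?
    countFin-cong P⇔Q = count-cong (λ j → does-⇔ (P⇔Q j) (P? j) (Q? j)) (allFin n)

    countFin-split : countFin P? ≡ countFin (λ j → P? j ×-dec Q? j) + countFin (λ j → P? j ×-dec ¬? (Q? j))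
    countFin-split = go (allFin n)
      where
      go : ∀ xs → count (does ∘ P?) xs ≡
           count (λ j → does (P? j) ∧ does (Q? j)) xs + count (λ j → does (P? j) ∧ not (does (Q? j))) xs
      go [] = refl
      go (x ∷ xs) with does (P? x) | does (Q? x)
      ... | false | _ = go xs
      ... | true | true = cong suc (go xs)
      ... | true | false = trans (cong suc (go xs)) (sym (+-suc _ _))

  module _ {P : Pred (Fin n) ℓ} (P? : Decidable P) where

    countFin-pos : ∀ {j} → P j → 0 < countFin P?
    countFin-pos {j} pj = go (allFin n) (∈-allFin j)
      where
      go : ∀ xs → j ∈ xs → 0 < count (does ∘ P?) xs
      go (x ∷ xs) (here refl) rewrite dec-true (P? j) pj = s≤s z≤n
      go (x ∷ xs) (there j∈xs) with does (P? x)
      ... | true = s≤s z≤n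
      ... | false = go xs j∈xs

    countFin-∃ : 0 < countFin P? → ∃ P
    countFin-∃ = go (allFin n)
      where
      go : ∀ xs → 0 < count (does ∘ P?) xs → ∃ P
      go (x ∷ xs) pos with P? x
      ... | yes px = x , px
      ... | no _ = go xs pos

    countFin-none : (∀ j → ¬ P j) → countFin P? ≡ 0
    countFin-none ¬P = go (allFin n)
      where
      go : ∀ xs → count (does ∘ P?) xs ≡ 0
      go [] = refl
      go (x ∷ xs) rewrite dec-false (P? x) (¬P x) = go xs

  countFin-singleton : (j₀ : Fin n) → countFin (Fin._≟ j₀) ≡ 1
  countFin-singleton j₀ = begin
    countFin (Fin._≟ j₀)                         ≡⟨ count-as-sum _ (allFin n) ⟩
    sum (map (λ j → if does (j Fin.≟ j₀) then 1 else 0) (allFin n))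
      ≡⟨ sum-allFin _ indicator (λ j → cong (if_then 1 else 0) (does-⇔ toℕ-≡ (j Fin.≟ j₀) (toℕ j ≟ toℕ j₀))) ⟩
    sumBelow indicator n                         ≡⟨ sym (+-identityʳ _) ⟩
    sumBelow indicator n + 0
      ≡⟨ sumBelow-update (toℕ<n j₀) (λ _ k≢j₀ → cong (if_then 1 else 0) (dec-false (_ ≟ _) k≢j₀)) ⟩
    sumBelow (λ _ → 0) n + indicator (toℕ j₀)
      ≡⟨ cong₂ _+_ (sumBelow-zero n (λ _ → refl)) (cong (if_then 1 else 0) (dec-true (toℕ j₀ ≟ toℕ j₀) refl)) ⟩
    1                                            ∎
    where
    open ≡-Reasoning
    indicator : ℕ → ℕ
    indicator k = if does (k ≟ toℕ j₀) then 1 else 0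
    toℕ-≡ : ∀ {j} → j ≡ j₀ ⇔ toℕ j ≡ toℕ j₀
    toℕ-≡ = mk⇔ (cong toℕ) toℕ-injective

-- The level profile of a cell

dim : ∀ {n} → CellIx n → ℕ → ℕ
dim φ k = countFin (λ j → toℕ (φ j) ≟ k)

module _ {n : ℕ} where

  dim-pos : (φ : CellIx n) (j : Fin n) → 0 < dim φ (toℕ (φ j))
  dim-pos φ j = countFin-pos (λ j → toℕ (φ j) ≟ _) refl

  dim-∃ : (φ : CellIx n) {k : ℕ} → 0 < dim φ k → ∃ λ j → toℕ (φ j) ≡ k
  dim-∃ φ = countFin-∃ (λ j → toℕ (φ j) ≟ _)

  dim-none : (φ : CellIx n) {k : ℕ} → (∀ j → toℕ (φ j) ≢ k) → dim φ k ≡ 0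
  dim-none φ = countFin-none (λ j → toℕ (φ j) ≟ _)

  dim-cong : (ψ φ : CellIx n) {k k' : ℕ} → (∀ j → toℕ (ψ j) ≡ k ⇔ toℕ (φ j) ≡ k') → dim ψ k ≡ dim φ k'
  dim-cong ψ φ = countFin-cong (λ j → toℕ (ψ j) ≟ _) (λ j → toℕ (φ j) ≟ _)

  dim-singleton : (ψ : CellIx n) {k : ℕ} (j₀ : Fin n) → (∀ j → toℕ (ψ j) ≡ k ⇔ j ≡ j₀) → dim ψ k ≡ 1
  dim-singleton ψ j₀ ψ⇔ = trans (countFin-cong (λ j → toℕ (ψ j) ≟ _) (Fin._≟ j₀) ψ⇔) (countFin-singleton j₀)

  dim-remove : (ψ φ : CellIx n) {k k' : ℕ} (j₀ : Fin n) → toℕ (φ j₀) ≡ k' →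
    (∀ j → toℕ (ψ j) ≡ k ⇔ (toℕ (φ j) ≡ k' × j ≢ j₀)) → suc (dim ψ k) ≡ dim φ k'
  dim-remove ψ φ {k} {k'} j₀ φj₀ ψ⇔ = sym (begin
    dim φ k'                                                   ≡⟨ countFin-split P? (Fin._≟ j₀) ⟩
    countFin (λ j → P? j ×-dec j Fin.≟ j₀) + countFin (λ j → P? j ×-dec ¬? (j Fin.≟ j₀))
      ≡⟨ cong₂ _+_ (countFin-cong (λ j → P? j ×-dec j Fin.≟ j₀) (Fin._≟ j₀) (λ j → mk⇔ proj₂ (λ { refl → φj₀ , refl })))
                   (sym (countFin-cong (λ j → toℕ (ψ j) ≟ k) (λ j → P? j ×-dec ¬? (j Fin.≟ j₀)) ψ⇔)) ⟩
    countFin (Fin._≟ j₀) + dim ψ k                            ≡⟨ cong (_+ dim ψ k) (countFin-singleton j₀) ⟩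
    suc (dim ψ k)                                              ∎)
    where
    open ≡-Reasoning
    P? : Decidable (λ j → toℕ (φ j) ≡ k')
    P? j = toℕ (φ j) ≟ k'

  sumBelow-dim : (φ : CellIx n) → ∀ m → sumBelow (dim φ) m ≡ countFin (λ j → toℕ (φ j) <? m)
  sumBelow-dim φ zero = sym (countFin-none (λ j → toℕ (φ j) <? 0) (λ _ ()))
  sumBelow-dim φ (suc m) = begin
    sumBelow (dim φ) m + dim φ m
      ≡⟨ cong₂ _+_ (trans (sumBelow-dim φ m) (countFin-cong <m? (λ j → <1+m? j ×-dec <m? j)
                                                 (λ j → mk⇔ (λ j<m → m<n⇒m<1+n j<m , j<m) proj₂)))
                   (countFin-cong (λ j → toℕ (φ j) ≟ m) (λ j → <1+m? j ×-dec ¬? (<m? j)) at-m) ⟩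
    countFin (λ j → <1+m? j ×-dec <m? j) + countFin (λ j → <1+m? j ×-dec ¬? (<m? j))
      ≡⟨ sym (countFin-split <1+m? <m?) ⟩
    countFin <1+m?                                                   ∎
    where
    open ≡-Reasoning
    <m? : Decidable (λ j → toℕ (φ j) < m)
    <m? j = toℕ (φ j) <? m
    <1+m? : Decidable (λ j → toℕ (φ j) < suc m)
    <1+m? j = toℕ (φ j) <? suc m
    at-m : ∀ j → toℕ (φ j) ≡ m ⇔ (toℕ (φ j) < suc m × ¬ toℕ (φ j) < m)
    at-m j = mk⇔ (λ { refl → n<1+n _ , <-irrefl refl })
                 (λ (j<1+m , j≮m) → ≤-antisym (s≤s⁻¹ j<1+m) (≮⇒≥ j≮m))

  dim-total : (φ : CellIx n) → sumBelow (dim φ) (suc n) ≡ n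
  dim-total φ = begin
    sumBelow (dim φ) (suc n)                   ≡⟨ sumBelow-dim φ (suc n) ⟩
    countFin (λ j → toℕ (φ j) <? suc n)        ≡⟨ count-cong (λ j → dec-true (_ <? suc n) (toℕ<n (φ j))) (allFin n) ⟩
    count (λ _ → true) (allFin n)              ≡⟨ count-true (allFin n) ⟩
    Data.List.length (allFin n)                ≡⟨ length-tabulate id ⟩
    n                                          ∎
    where
    open ≡-Reasoning
    count-true : ∀ xs → count (λ _ → true) xs ≡ Data.List.length xs
    count-true [] = refl
    count-true (_ ∷ xs) = cong suc (count-true xs)

TopCrowded : ℕ → (ℕ → ℕ) → ℕ → Set
TopCrowded n T = LastBelow (λ k → 1 < T k) (suc n) 0

LastZero : ℕ → (ℕ → ℕ) → ℕ → Set
LastZero n T = LastBelow (λ k → T k ≡ 0) (suc n) 0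

Bounded : ℕ → (ℕ → ℕ) → Set
Bounded n T = ∀ {J} → J < n → sumBelow T (suc J) ≤ suc J

GValue : ℕ → (ℕ → ℕ) → ℕ → Set
GValue n T K = ∃ λ I → TopCrowded n T I × zerosBelow T I ≡ K

isZ-indicator : ∀ m → (if isZ m then 1 else 0) ≡ isZero m
isZ-indicator zero = refl
isZ-indicator (suc m) = refl

module _ {n : ℕ} (a : Coeffs n) (φ : CellIx n) where

  isInterval-comp : ∀ i j → isInterval (comp a φ i j) ≡ does (toℕ (φ j) ≟ toℕ i)
  isInterval-comp i j with toℕ i <ᵇ toℕ (φ j) | <ᵇ-reflects-< (toℕ i) (toℕ (φ j))
  ... | true | ofʸ i<φj = sym (dec-false (toℕ (φ j) ≟ toℕ i) (>⇒≢ i<φj))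
  ... | false | _ with toℕ (φ j) ≡ᵇ toℕ i
  ...   | true = refl
  ...   | false = refl

  t≡dim : ∀ i → t a φ i ≡ dim φ (toℕ i)
  t≡dim i = count-cong (isInterval-comp i) (allFin n)

  count-zeroLevels : count (λ i → isZ (t a φ i)) (allFin (suc n)) ≡ zerosBelow (dim φ) (suc n)
  count-zeroLevels = trans (count-as-sum _ (allFin (suc n)))
    (sum-allFin _ (isZero ∘ dim φ) (λ i → trans (cong (λ m → if isZ m then 1 else 0) (t≡dim i)) (isZ-indicator _)))

  iOf-view : LastZero n (dim φ) (toℕ (iOf a φ))
  iOf-view = subst (LastZero n (dim φ)) (sym (lastSat-allFin (λ k → dim φ k ≟ 0) (λ i → cong isZ (t≡dim i)) Fin.zero))
                   (lastBelow-view _ (suc n) 0)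

  Ib-≡ : Ib a φ ≡ lastBelow (λ k → 1 <? dim φ k) (suc n) 0
  Ib-≡ with mixed a φ in isMixed
  -- A mixed cell has no crowded level, so I_b = 0 is the default value of lastBelow.
  ... | true = LastBelow-functional (none notCrowded) (lastBelow-view _ (suc n) 0)
    where
    oneZero : zerosBelow (dim φ) (suc n) ≡ 1
    oneZero = trans (sym count-zeroLevels) (≡ᵇ⇒≡ _ 1 (subst Data.Bool.T (sym isMixed) _))
    notCrowded : ∀ {k} → k < suc n → ¬ 1 < dim φ k
    notCrowded k≤n crowded = <-irrefl (sym (trans (cong₂ _+_ (dim-total φ) oneZero) (+-comm n 1)))
      (crowded⇒sumBelow-+-zerosBelow (dim φ) k≤n crowded)
  ... | false = lastSat-allFin (λ k → 1 <? dim φ k) (λ i → cong (1 <ᵇ_) (t≡dim i)) Fin.zero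

  Ib-view : TopCrowded n (dim φ) (Ib a φ)
  Ib-view = subst (TopCrowded n (dim φ)) (sym Ib-≡) (lastBelow-view _ (suc n) 0)

  Ib≤ : Ib a φ ≤ suc n
  Ib≤ with Ib a φ | Ib-view
  ... | _ | none _ = z≤n
  ... | _ | found I≤n _ _ = <⇒≤ I≤n

  gOf-≡ : gOf a φ ≡ zerosBelow (dim φ) (Ib a φ)
  gOf-≡ = begin
    gOf a φ
      ≡⟨ count-as-sum _ (allFin (suc n)) ⟩
    sum (map (λ i → if (toℕ i <ᵇ Ib a φ) ∧ isZ (t a φ i) then 1 else 0) (allFin (suc n)))
      ≡⟨ sum-allFin _ (λ k → if k <ᵇ Ib a φ then isZero (dim φ k) else 0) (λ i → indicator (toℕ i <ᵇ Ib a φ) i) ⟩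
    sumBelow (λ k → if k <ᵇ Ib a φ then isZero (dim φ k) else 0) (suc n)
      ≡⟨ sumBelow-restrict (isZero ∘ dim φ) Ib≤ ⟩
    zerosBelow (dim φ) (Ib a φ)
      ∎
    where
    open ≡-Reasoning
    indicator : ∀ b i → (if b ∧ isZ (t a φ i) then 1 else 0) ≡ (if b then isZero (dim φ (toℕ i)) else 0)
    indicator false i = refl
    indicator true i = trans (cong (λ m → if isZ m then 1 else 0) (t≡dim i)) (isZ-indicator _)

  gOf-topCrowded : ∀ {I} → TopCrowded n (dim φ) I → gOf a φ ≡ zerosBelow (dim φ) I
  gOf-topCrowded top = trans gOf-≡ (cong (zerosBelow (dim φ)) (LastBelow-functional Ib-view top))

  GValue⇒gOf : ∀ {K} → GValue n (dim φ) K → gOf a φ ≡ K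
  GValue⇒gOf (I , top , zeros) = trans (gOf-topCrowded top) zeros

  InG⇔Bounded : InG a φ ⇔ Bounded n (dim φ)
  InG⇔Bounded = mk⇔ to from
    where
    levelSum : ∀ (I : Fin (suc n)) →
      sum (map (t a φ) (filterᵇ (λ i → toℕ i <ᵇ suc (toℕ I)) (allFin (suc n)))) ≡ sumBelow (dim φ) (suc (toℕ I))
    levelSum I = sum-filter-allFin (t a φ) (dim φ) t≡dim (toℕ<n I)
    to : InG a φ → Bounded n (dim φ)
    to inG {J} J<n with fromℕ< (m<n⇒m<1+n J<n) | toℕ-fromℕ< (m<n⇒m<1+n J<n)
    ... | I | refl = subst (_≤ suc (toℕ I)) (levelSum I) (inG I J<n)
    from : Bounded n (dim φ) → InG a φ
    from bounded I I<n = subst (_≤ suc (toℕ I)) (sym (levelSum I)) (bounded I<n)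

module _ {n : ℕ} (a : Coeffs n) (j : Fin n) where

  private
    coeff : ℕ → ℕ
    coeff k with k <? suc n
    ... | yes k≤n = a (fromℕ< k≤n) j
    ... | no _ = 0

    coeff-toℕ : ∀ x → a x j ≡ coeff (toℕ x)
    coeff-toℕ x with toℕ x <? suc n
    ... | yes x≤n = cong (λ y → a y j) (sym (fromℕ<-toℕ x x≤n))
    ... | no x≰n = contradiction (toℕ<n x) x≰n

  prefix-suc : ∀ x → prefix a (suc (toℕ x)) j ≡ prefix a (toℕ x) j + a x j
  prefix-suc x = begin
    prefix a (suc (toℕ x)) j     ≡⟨ sum-filter-allFin (λ k → a k j) coeff coeff-toℕ (toℕ<n x) ⟩
    sumBelow coeff (toℕ x) + coeff (toℕ x)
      ≡⟨ cong₂ _+_ (sym (sum-filter-allFin (λ k → a k j) coeff coeff-toℕ (<⇒≤ (toℕ<n x)))) (sym (coeff-toℕ x)) ⟩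
    prefix a (toℕ x) j + a x j   ∎
    where open ≡-Reasoning

module _ {n : ℕ} (a : Coeffs n) (φ : CellIx n) (j : Fin n) where

  aOf≤ : aOf a φ j ≤ a (iOf a φ) j
  aOf≤ with toℕ (iOf a φ) <ᵇ toℕ (φ j)
  ... | true = ≤-refl
  ... | false with finEq (φ j) (iOf a φ)
  ...   | true = z≤n
  ...   | false = z≤n

  aOf≡0 : ¬ toℕ (iOf a φ) < toℕ (φ j) → aOf a φ j ≡ 0
  aOf≡0 i≮φj with toℕ (iOf a φ) <ᵇ toℕ (φ j) | <ᵇ-reflects-< (toℕ (iOf a φ)) (toℕ (φ j))
  ... | true | ofʸ i<φj = contradiction i<φj i≮φj
  ... | false | _ with finEq (φ j) (iOf a φ)
  ...   | true = refl
  ...   | false = refl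

-- Profiles of predecessors

m+[o∸n]≤o⇒m≤n : ∀ {m n o} → n ≤ o → m + (o ∸ n) ≤ o → m ≤ n
m+[o∸n]≤o⇒m≤n {m} {n} {o} n≤o le = +-cancelʳ-≤ (o ∸ n) m n (subst (m + (o ∸ n) ≤_) (sym (m+[n∸m]≡n n≤o)) le)

crowded⇒emptyBelow : ∀ {n T q} → Bounded n T → q < n → 1 < T q → ¬ (∀ {k} → k < q → T k ≢ 0)
crowded⇒emptyBelow {n} {T} {q} bounded q<n crowded nonempty = <-irrefl refl (begin-strict
  suc q                      <⟨ n<1+n (suc q) ⟩
  2 + q                      ≤⟨ +-mono-≤ crowded (sumBelow-lowerBound z≤n (λ _ k<q → n≢0⇒n>0 (nonempty k<q))) ⟩
  T q + sumBelow T q         ≡⟨ +-comm (T q) _ ⟩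
  sumBelow T (suc q)         ≤⟨ bounded q<n ⟩
  suc q                      ∎)
  where open ≤-Reasoning

module DropEmptyLevel
  {n : ℕ} (T T' : ℕ → ℕ) {K I' z : ℕ}
  (total : sumBelow T (suc n) ≡ n) (bounded : Bounded n T)
  (I'<n : I' < n) (crowded : 1 < T (suc I')) (uncrowded : ∀ {k} → suc I' < k → k < suc n → ¬ 1 < T k)
  (zeros : zerosBelow T (suc I') ≡ suc K)
  (zero-z : T z ≡ 0) (nonzero : ∀ {k} → z < k → k < suc n → T k ≢ 0) (z≤I' : z ≤ I')
  (same : ∀ {k} → k < z → T' k ≡ T k) (shifted : ∀ {k} → z ≤ k → k < n → T' k ≡ T (suc k)) (empty : T' n ≡ 0)
  where

  bounded' : Bounded n T'
  bounded' {J} J<n with suc J ≤? z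
  ... | yes 1+J≤z = subst (_≤ suc J) (sumBelow-cong (suc J) (λ k<1+J → sym (same (<-≤-trans k<1+J 1+J≤z)))) (bounded J<n)
  ... | no 1+J≰z = m+[o∸n]≤o⇒m≤n J<n (begin
    sumBelow T' (suc J) + (n ∸ suc J)          ≡⟨ cong (_+ (n ∸ suc J)) deleted ⟨
    sumBelow T (suc (suc J)) + (n ∸ suc J)     ≤⟨ sumBelow-lowerBound (s≤s J<n) (λ 2+J≤k k≤n →
                                                    n≢0⇒n>0 (nonzero (<-≤-trans (s≤s (m≤n⇒m≤1+n z≤J)) 2+J≤k) k≤n)) ⟩
    sumBelow T (suc n)                         ≡⟨ total ⟩
    n                                          ∎)
    where
    open ≤-Reasoning
    z≤J : z ≤ J
    z≤J = s≤s⁻¹ (≰⇒> 1+J≰z)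
    deleted : sumBelow T (suc (suc J)) ≡ sumBelow T' (suc J)
    deleted = trans (sumBelow-delete same shifted (m≤n⇒m≤1+n z≤J) J<n) (trans (cong (_ +_) zero-z) (+-identityʳ _))

  topCrowded' : TopCrowded n T' I'
  topCrowded' = found (m<n⇒m<1+n I'<n) (subst (1 <_) (sym (shifted z≤I' I'<n)) crowded) uncrowded'
    where
    uncrowded' : ∀ {k} → I' < k → k < suc n → ¬ 1 < T' k
    uncrowded' {k} I'<k k≤n with m≤n⇒m<n∨m≡n (s≤s⁻¹ k≤n)
    ... | inj₁ k<n = subst (¬_ ∘ (1 <_)) (sym (shifted (≤-trans z≤I' (<⇒≤ I'<k)) k<n)) (uncrowded (s≤s I'<k) (s≤s k<n))
    ... | inj₂ refl = subst (¬_ ∘ (1 <_)) (sym empty) λ ()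

  zeros' : zerosBelow T' I' ≡ K
  zeros' = suc-injective (begin
    suc (zerosBelow T' I')               ≡⟨ +-comm 1 _ ⟩
    zerosBelow T' I' + 1                 ≡⟨ cong ((zerosBelow T' I' +_) ∘ isZero) zero-z ⟨
    zerosBelow T' I' + isZero (T z)      ≡⟨ sumBelow-delete (cong isZero ∘ same) (λ z≤k k<n → cong isZero (shifted z≤k k<n))
                                                            z≤I' (<⇒≤ I'<n) ⟨
    zerosBelow T (suc I')                ≡⟨ zeros ⟩
    suc K                                ∎)
    where open ≡-Reasoning

  gValue' : GValue n T' K
  gValue' = I' , topCrowded' , zeros'

module BorrowFromCrowded
  {n : ℕ} (T T' : ℕ → ℕ) {K I z q₀ z₂ : ℕ}
  (total' : sumBelow T' (suc n) ≡ n) (bounded : Bounded n T)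
  (I<1+n : I < suc n) (crowded : 1 < T I) (uncrowded : ∀ {k} → I < k → k < suc n → ¬ 1 < T k)
  (zeros : zerosBelow T I ≡ suc K)
  (z<1+n : z < suc n) (zero-z : T z ≡ 0) (nonzero : ∀ {k} → z < k → k < suc n → T k ≢ 0) (I<z : I < z)
  (q≤I : suc q₀ ≤ I) (crowded-q : 1 < T (suc q₀))
  (q-choice : suc q₀ < I ⊎ (suc q₀ ≡ I × ∀ {k} → k < I → ¬ 1 < T k))
  (z₂≤q₀ : z₂ ≤ q₀) (zero-z₂ : T z₂ ≡ 0) (nonzero₂ : ∀ {k} → z₂ < k → k < suc q₀ → T k ≢ 0)
  (same : ∀ {k} → k < z₂ → T' k ≡ T k) (shifted : ∀ {k} → z₂ ≤ k → k < q₀ → T' k ≡ T (suc k))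
  (lent : T' q₀ ≡ 1) (lender : suc (T' (suc q₀)) ≡ T (suc q₀)) (same-above : ∀ {k} → suc q₀ < k → T' k ≡ T k)
  where

  nonzero' : ∀ {k} → z₂ ≤ k → k ≤ suc q₀ → T' k ≢ 0
  nonzero' {k} z₂≤k k≤q with <-cmp k q₀
  ... | tri< k<q₀ _ _ = subst (_≢ 0) (sym (shifted z₂≤k k<q₀)) (nonzero₂ (s≤s z₂≤k) (s≤s k<q₀))
  ... | tri≈ _ refl _ = subst (_≢ 0) (sym lent) λ ()
  ... | tri> _ _ q₀<k with ≤-antisym k≤q q₀<k
  ...   | refl = λ T'q≡0 → contradiction (subst (0 <_) T'q≡0 (s≤s⁻¹ (subst (1 <_) (sym lender) crowded-q))) λ ()

  nonzero-q : ∀ {k} → z₂ < k → k ≤ suc q₀ → T k ≢ 0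
  nonzero-q {k} z₂<k k≤q with m≤n⇒m<n∨m≡n k≤q
  ... | inj₁ k<q = nonzero₂ z₂<k k<q
  ... | inj₂ refl = λ Tq≡0 → contradiction (subst (1 <_) Tq≡0 crowded-q) λ ()

  isZero-away : ∀ {k} → k ≢ z₂ → isZero (T' k) ≡ isZero (T k)
  isZero-away {k} k≢z₂ with <-cmp k z₂ | k ≤? suc q₀
  ... | tri< k<z₂ _ _ | _ = cong isZero (same k<z₂)
  ... | tri≈ _ k≡z₂ _ | _ = contradiction k≡z₂ k≢z₂
  ... | tri> _ _ z₂<k | yes k≤q = trans (isZero-≢0 (nonzero' (<⇒≤ z₂<k) k≤q)) (sym (isZero-≢0 (nonzero-q z₂<k k≤q)))
  ... | tri> _ _ _ | no k≰q = cong isZero (same-above (≰⇒> k≰q))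

  zeros' : zerosBelow T' I ≡ K
  zeros' = suc-injective (begin
    suc (zerosBelow T' I)                ≡⟨ +-comm 1 _ ⟩
    zerosBelow T' I + 1                  ≡⟨ cong ((zerosBelow T' I +_) ∘ isZero) zero-z₂ ⟨
    zerosBelow T' I + isZero (T z₂)      ≡⟨ sumBelow-update (<-≤-trans (s≤s z₂≤q₀) q≤I) (λ _ → sym ∘ isZero-away) ⟨
    zerosBelow T I + isZero (T' z₂)      ≡⟨ cong₂ _+_ zeros (isZero-≢0 (nonzero' ≤-refl (m≤n⇒m≤1+n z₂≤q₀))) ⟩
    suc K + 0                            ≡⟨ +-identityʳ _ ⟩
    suc K                                ∎)
    where open ≡-Reasoning

  q<z : suc q₀ < z
  q<z = ≤-<-trans q≤I I<z

  sum-shift : ∀ {m} → z₂ ≤ m → m ≤ q₀ → sumBelow T (suc m) ≡ sumBelow T' m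
  sum-shift z₂≤m m≤q₀ = trans (sumBelow-delete same shifted z₂≤m m≤q₀) (trans (cong (_ +_) zero-z₂) (+-identityʳ _))

  sum-q : sumBelow T' (suc q₀) ≡ suc (sumBelow T (suc q₀))
  sum-q = trans (cong₂ _+_ (sym (sum-shift z₂≤q₀ ≤-refl)) lent) (+-comm _ 1)

  sum-above : ∀ {m} → suc q₀ < m → sumBelow T' m ≡ sumBelow T m
  sum-above q<m = sumBelow-extend q<m (begin
    sumBelow T' (suc q₀) + T' (suc q₀)         ≡⟨ cong (_+ T' (suc q₀)) sum-q ⟩
    suc (sumBelow T (suc q₀)) + T' (suc q₀)    ≡⟨ +-suc _ _ ⟨
    sumBelow T (suc q₀) + suc (T' (suc q₀))    ≡⟨ cong (sumBelow T (suc q₀) +_) lender ⟩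
    sumBelow T (suc q₀) + T (suc q₀)           ∎) (λ q<k _ → same-above q<k)
    where open ≡-Reasoning

  sum-q≤ : sumBelow T (suc q₀) ≤ q₀
  sum-q≤ = +-cancelʳ-≤ 2 _ q₀ (begin
    sumBelow T (suc q₀) + 2               ≤⟨ +-monoʳ-≤ _ crowded-q ⟩
    sumBelow T (suc q₀) + T (suc q₀)      ≤⟨ bounded (<-≤-trans q<z (s≤s⁻¹ z<1+n)) ⟩
    suc (suc q₀)                          ≡⟨ +-comm 2 q₀ ⟩
    q₀ + 2                                ∎)
    where open ≤-Reasoning

  bounded-shifted : ∀ {J} → z₂ ≤ J → J < q₀ → sumBelow T' (suc J) ≤ suc J
  bounded-shifted {J} z₂≤J J<q₀ = m+[o∸n]≤o⇒m≤n J<q₀ (begin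
    sumBelow T' (suc J) + (q₀ ∸ suc J)          ≡⟨ cong (_+ (q₀ ∸ suc J)) (sum-shift (m≤n⇒m≤1+n z₂≤J) J<q₀) ⟨
    sumBelow T (suc (suc J)) + (q₀ ∸ suc J)      ≤⟨ sumBelow-lowerBound (s≤s J<q₀) (λ 2+J≤k k<q →
                                                      n≢0⇒n>0 (nonzero₂ (<-≤-trans (s≤s (m≤n⇒m≤1+n z₂≤J)) 2+J≤k) k<q)) ⟩
    sumBelow T (suc q₀)                          ≤⟨ sum-q≤ ⟩
    q₀                                           ∎)
    where open ≤-Reasoning

  bounded' : Bounded n T'
  bounded' {J} J<n with suc J ≤? z₂
  ... | yes 1+J≤z₂ = subst (_≤ suc J) (sumBelow-cong (suc J) (λ k<1+J → sym (same (<-≤-trans k<1+J 1+J≤z₂)))) (bounded J<n)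
  ... | no 1+J≰z₂ with <-cmp J q₀
  ...   | tri< J<q₀ _ _ = bounded-shifted (s≤s⁻¹ (≰⇒> 1+J≰z₂)) J<q₀
  ...   | tri≈ _ refl _ = subst (_≤ suc J) (sym sum-q) (s≤s sum-q≤)
  ...   | tri> _ _ q₀<J = subst (_≤ suc J) (sym (sum-above (s≤s q₀<J))) (bounded J<n)

  uncrowded' : ∀ {k} → I < k → k < suc n → ¬ 1 < T' k
  uncrowded' I<k k≤n = subst (¬_ ∘ (1 <_)) (sym (same-above (≤-<-trans q≤I I<k))) (uncrowded I<k k≤n)

  flat⇒K≡0 : (∀ {k} → k < suc n → ¬ 1 < T' k) → K ≡ 0
  flat⇒K≡0 flat = n≤0⇒n≡0 (s≤s⁻¹ (begin
    suc K                        ≡⟨ +-comm 1 K ⟩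
    K + 1                        ≡⟨ cong₂ _+_ zeros' (cong isZero (trans (same-above q<z) zero-z)) ⟨
    zerosBelow T' I + isZero (T' z)  ≤⟨ +-monoˡ-≤ _ (sumBelow-mono (<⇒≤ I<z)) ⟩
    zerosBelow T' (suc z)        ≤⟨ sumBelow-mono z<1+n ⟩
    zerosBelow T' (suc n)        ≡⟨ +-cancelˡ-≡ n _ 1 (trans (cong (_+ zerosBelow T' (suc n)) (sym total'))
                                                   (trans (flat⇒sumBelow-+-zerosBelow T' flat) (+-comm 1 n))) ⟩
    1                            ∎))
    where open ≤-Reasoning

  lastZero' : LastZero n T' z
  lastZero' = found z<1+n (trans (same-above q<z) zero-z)
    (λ z<k k≤n → subst (_≢ 0) (sym (same-above (<-trans q<z z<k))) (nonzero z<k k≤n))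

  flat' : (∀ {k} → k < suc q₀ → ¬ 1 < T k) → (∀ {k} → suc q₀ < k → k < suc n → ¬ 1 < T k) → ¬ 2 < T (suc q₀) →
    ∀ {k} → k < suc n → ¬ 1 < T' k
  flat' below above ¬2<Tq {k} k≤n with <-cmp k q₀
  ... | tri≈ _ refl _ = subst (¬_ ∘ (1 <_)) (sym lent) (<-irrefl refl)
  ... | tri< k<q₀ _ _ with k <? z₂
  ...   | yes k<z₂ = subst (¬_ ∘ (1 <_)) (sym (same k<z₂)) (below (m<n⇒m<1+n k<q₀))
  ...   | no k≮z₂ = subst (¬_ ∘ (1 <_)) (sym (shifted (≮⇒≥ k≮z₂) k<q₀)) (below (s≤s k<q₀))
  flat' below above ¬2<Tq {k} k≤n | tri> _ _ q₀<k with m≤n⇒m<n∨m≡n q₀<k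
  ... | inj₁ q<k = subst (¬_ ∘ (1 <_)) (sym (same-above q<k)) (above q<k k≤n)
  ... | inj₂ refl = λ 1<T'q → ¬2<Tq (subst (2 <_) lender (s≤s 1<T'q))

  gValue' : GValue n T' K
  gValue' = by q-choice
    where
    by : suc q₀ < I ⊎ (suc q₀ ≡ I × ∀ {k} → k < I → ¬ 1 < T k) → GValue n T' K
    by (inj₁ q<I) = I , found I<1+n (subst (1 <_) (sym (same-above q<I)) crowded) uncrowded' , zeros'
    by (inj₂ (refl , below)) with 2 <? T (suc q₀)
    ... | yes 2<Tq = suc q₀ , found I<1+n (s≤s⁻¹ (subst (2 <_) (sym lender) 2<Tq)) uncrowded' , zeros'
    ... | no 2≮Tq = 0 , none (flat' below uncrowded 2≮Tq) , sym (flat⇒K≡0 (flat' below uncrowded 2≮Tq))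

-- Lowering coordinates

-- HasType a b φ unfolds to ∀ j → InSlab a j (φ j) (b j): in coordinate j, level x
-- is the segment prefix a x j ≤ v < prefix a (x + 1) j.
InSlab : ∀ {n} → Coeffs n → Fin n → Fin (suc n) → ℕ → Set
InSlab a j x v = prefix a (toℕ x) j ≤ v × v < prefix a (suc (toℕ x)) j

StepAt : ∀ {n} → Coeffs n → CellIx n → Fin n → ℕ → ℕ → Set
StepAt a ψ j u v = (u ≤ v + aOf a ψ j) × (v + aOf a ψ j ≤ u + a (iOf a ψ) j)

suc-toℕ-pred : ∀ {m} (x : Fin (suc m)) → 0 < toℕ x → suc (toℕ (Fin.pred x)) ≡ toℕ x
suc-toℕ-pred (Fin.suc y) _ = cong suc (toℕ-inject₁ y)

module _ {n : ℕ} (a : Coeffs n) (pos : ∀ i j → 0 < a i j) where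

  prefix-pos : ∀ {j} (x : Fin (suc n)) → 0 < toℕ x → 0 < prefix a (toℕ x) j
  prefix-pos {j} x x>0 =
    subst (0 <_) (trans (sym (prefix-suc a j (Fin.pred x))) (cong (λ v → prefix a v j) (suc-toℕ-pred x x>0)))
          (<-≤-trans (pos (Fin.pred x) j) (m≤n+m _ _))

  slab-first : ∀ j x → InSlab a j x (prefix a (toℕ x) j)
  slab-first j x = ≤-refl , subst (prefix a (toℕ x) j <_) (sym (prefix-suc a j x)) (m<m+n _ (pos x j))

  slab-lastBefore : ∀ j (x : Fin (suc n)) → 0 < toℕ x → InSlab a j (Fin.pred x) (prefix a (toℕ x) j ∸ 1)
  slab-lastBefore j x x>0 rewrite sym (suc-toℕ-pred x x>0) | prefix-suc a j (Fin.pred x) =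
      subst (base ≤_) (sym (+-∸-assoc base (pos (Fin.pred x) j))) (m≤m+n base _)
    , ∸-monoʳ-< {o = 0} (s≤s z≤n) (≤-trans (pos (Fin.pred x) j) (m≤n+m _ base))
    where
    base : ℕ
    base = prefix a (toℕ (Fin.pred x)) j

  slab-fromLastBefore : ∀ {j v} (x : Fin (suc n)) → 0 < toℕ x → InSlab a j x v →
    prefix a (toℕ x) j ∸ 1 ≤ v × v ≤ prefix a (toℕ x) j ∸ 1 + a x j
  slab-fromLastBefore {j} {v} x x>0 (P≤v , v<P') =
    ≤-trans (m∸n≤m _ 1) P≤v , pred-+ (prefix-pos x x>0) (subst (v <_) (prefix-suc a j x) v<P')
    where
    pred-+ : ∀ {p A} → 0 < p → v < p + A → v ≤ p ∸ 1 + A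
    pred-+ {suc p} _ (s≤s v≤p+A) = v≤p+A

  stepAt-stay : ∀ ψ j u → StepAt a ψ j u u
  stepAt-stay ψ j u = m≤m+n u _ , +-monoʳ-≤ u (aOf≤ a ψ j)

  stepAt-rise : ∀ ψ j {u v} → ¬ toℕ (iOf a ψ) < toℕ (ψ j) → u ≤ v → v ≤ u + a (iOf a ψ) j → StepAt a ψ j u v
  stepAt-rise ψ j {u} {v} i≮ψj u≤v v≤ rewrite aOf≡0 a ψ j i≮ψj | +-identityʳ v = u≤v , v≤

  stepAt-up : ∀ ψ j {u} → ¬ toℕ (iOf a ψ) < toℕ (ψ j) → 0 < u → StepAt a ψ j (u ∸ 1) u
  stepAt-up ψ j {u} i≮ψj u>0 = stepAt-rise ψ j i≮ψj (m∸n≤m u 1)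
    (subst (_≤ u ∸ 1 + a (iOf a ψ) j) (m∸n+n≡m u>0) (+-monoʳ-≤ (u ∸ 1) (pos (iOf a ψ) j)))

  ≤-sum-allFin : (y : Pt n) (j : Fin n) → y j ≤ sum (map y (allFin n))
  ≤-sum-allFin y j = go (allFin n) (∈-allFin j)
    where
    go : ∀ xs → j ∈ xs → y j ≤ sum (map y xs)
    go (_ ∷ xs) (here refl) = m≤m+n (y j) _
    go (x ∷ xs) (there j∈xs) = ≤-trans (go xs j∈xs) (m≤n+m _ (y x))

  module _ (φ : CellIx n) where

    walk-≤ : ∀ r {x y : Pt n} → HasType a x φ → HasType a y φ → (∀ j → x j ≤ y j) → (∀ j → y j ≤ x j + r) →
      (∀ {j} → x j < y j → toℕ (φ j) < toℕ (iOf a φ)) → Reach a x y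
    walk-≤ zero {x} {y} hx hy x≤y y≤x below = step φ hx arrive done
      where
      arrive : Step a x φ y
      arrive j = subst (StepAt a φ j (x j)) (≤-antisym (x≤y j) (subst (y j ≤_) (+-identityʳ _) (y≤x j)))
                       (stepAt-stay φ j (x j))
    walk-≤ (suc r) {x} {y} hx hy x≤y y≤x+r below = step φ hx advance (walk-≤ r hx' hy (λ j → m⊓n≤n _ _) y≤x'+r below')
      where
      x' : Pt n
      x' j = suc (x j) ⊓ y j
      x≤x' : ∀ j → x j ≤ x' j
      x≤x' j = ⊓-glb (n≤1+n _) (x≤y j)
      cases : ∀ j → (x j < y j × x' j ≡ suc (x j)) ⊎ (x j ≡ y j × x' j ≡ y j)
      cases j with x j <? y j
      ... | yes x<y = inj₁ (x<y , m≤n⇒m⊓n≡m x<y)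
      ... | no x≮y = inj₂ (≤-antisym (x≤y j) (≮⇒≥ x≮y) , m≥n⇒m⊓n≡n (≤-trans (≮⇒≥ x≮y) (n≤1+n _)))
      advance : Step a x φ x'
      advance j with cases j
      ... | inj₁ (x<y , x'≡) = subst (StepAt a φ j (x j)) (sym x'≡)
            (stepAt-rise φ j (<⇒≯ (below x<y)) (n≤1+n _)
                         (subst (_≤ x j + a (iOf a φ) j) (+-comm (x j) 1) (+-monoʳ-≤ (x j) (pos _ j))))
      ... | inj₂ (x≡y , x'≡) = subst (StepAt a φ j (x j)) (trans x≡y (sym x'≡)) (stepAt-stay φ j (x j))
      hx' : HasType a x' φ
      hx' j = ≤-trans (proj₁ (hx j)) (x≤x' j) , ≤-<-trans (m⊓n≤n _ _) (proj₂ (hy j))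
      y≤x'+r : ∀ j → y j ≤ x' j + r
      y≤x'+r j with cases j
      ... | inj₁ (_ , x'≡) = subst (y j ≤_) (trans (+-suc (x j) r) (cong (_+ r) (sym x'≡))) (y≤x+r j)
      ... | inj₂ (_ , x'≡) = subst (λ v → y j ≤ v + r) (sym x'≡) (m≤m+n (y j) r)
      below' : ∀ {j} → x' j < y j → toℕ (φ j) < toℕ (iOf a φ)
      below' {j} x'<y = below (≤-<-trans (x≤x' j) x'<y)

    walk : ∀ {x y : Pt n} → HasType a x φ → HasType a y φ → (∀ j → x j ≤ y j) →
      (∀ {j} → x j < y j → toℕ (φ j) < toℕ (iOf a φ)) → Reach a x y
    walk {x} {y} hx hy x≤y = walk-≤ (sum (map y (allFin n))) hx hy x≤y (λ j → ≤-trans (≤-sum-allFin y j) (m≤n+m _ (x j)))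

module Lowering {n : ℕ} (a : Coeffs n) (pos : ∀ i j → 0 < a i j) (φ : CellIx n)
  {M : Pred (Fin n) ℓ} (M? : Decidable M) (M⇒pos : ∀ {j} → M j → 0 < toℕ (φ j)) where

  lowered : CellIx n
  lowered j with M? j
  ... | yes _ = Fin.pred (φ j)
  ... | no _ = φ j

  lowerPt : Pt n → Pt n
  lowerPt b j with M? j
  ... | yes _ = prefix a (toℕ (φ j)) j ∸ 1
  ... | no _ = b j

  floorPt : Pt n → Pt n
  floorPt b j with M? j
  ... | yes _ = prefix a (toℕ (φ j)) j
  ... | no _ = b j

  module _ {j : Fin n} where

    toℕ-lowered-moved : M j → suc (toℕ (lowered j)) ≡ toℕ (φ j)
    toℕ-lowered-moved m with M? j
    ... | yes _ = suc-toℕ-pred (φ j) (M⇒pos m)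
    ... | no ¬m = contradiction m ¬m

    lowered-kept : ¬ M j → lowered j ≡ φ j
    lowered-kept ¬m with M? j
    ... | yes m = contradiction m ¬m
    ... | no _ = refl

    lowerPt-moved : ∀ {b} → M j → lowerPt b j ≡ prefix a (toℕ (φ j)) j ∸ 1
    lowerPt-moved m with M? j
    ... | yes _ = refl
    ... | no ¬m = contradiction m ¬m

    lowerPt-kept : ∀ {b} → ¬ M j → lowerPt b j ≡ b j
    lowerPt-kept ¬m with M? j
    ... | yes m = contradiction m ¬m
    ... | no _ = refl

    floorPt-moved : ∀ {b} → M j → floorPt b j ≡ prefix a (toℕ (φ j)) j
    floorPt-moved m with M? j
    ... | yes _ = refl
    ... | no ¬m = contradiction m ¬m

    floorPt-kept : ∀ {b} → ¬ M j → floorPt b j ≡ b j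
    floorPt-kept ¬m with M? j
    ... | yes m = contradiction m ¬m
    ... | no _ = refl

  module _ {b : Pt n} (hb : HasType a b φ) where

    hasType-lowerPt : HasType a (lowerPt b) lowered
    hasType-lowerPt j with M? j
    ... | yes m = slab-lastBefore a pos j (φ j) (M⇒pos m)
    ... | no _ = hb j

    hasType-floorPt : HasType a (floorPt b) φ
    hasType-floorPt j with M? j
    ... | yes _ = slab-first a pos j (φ j)
    ... | no _ = hb j

    floorPt≤ : ∀ j → floorPt b j ≤ b j
    floorPt≤ j with M? j
    ... | yes _ = proj₁ (hb j)
    ... | no _ = ≤-refl

    floorPt<⇒moved : ∀ {j} → floorPt b j < b j → M j
    floorPt<⇒moved {j} fl<b with M? j
    ... | yes m = m
    ... | no _ = contradiction fl<b (<-irrefl refl)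

    step-lowerPt-floorPt : (∀ {j} → M j → toℕ (lowered j) < toℕ (iOf a lowered)) → Step a (lowerPt b) lowered (floorPt b)
    step-lowerPt-floorPt below j = by (M? j)
      where
      by : Dec (M j) → StepAt a lowered j (lowerPt b j) (floorPt b j)
      by (yes m) = subst₂ (StepAt a lowered j) (sym (lowerPt-moved m)) (sym (floorPt-moved m))
                          (stepAt-up a pos lowered j (<⇒≯ (below m)) (prefix-pos a pos (φ j) (M⇒pos m)))
      by (no ¬m) = subst₂ (StepAt a lowered j) (sym (lowerPt-kept ¬m)) (sym (floorPt-kept ¬m))
                          (stepAt-stay a pos lowered j (b j))

module LowerAboveEmpty {n : ℕ} (a : Coeffs n) (pos : ∀ i j → 0 < a i j) (φ : CellIx n) {b : Pt n} (hb : HasType a b φ)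
  {z : ℕ} (zero-z : dim φ z ≡ 0) (nonzero : ∀ {k} → z < k → k < suc n → dim φ k ≢ 0) where

  Raised : ℕ → Fin n → Set
  Raised p j = z < toℕ (φ j) × toℕ (φ j) ≤ p

  Raised? : ∀ p → Decidable (Raised p)
  Raised? p j = (z <? toℕ (φ j)) ×-dec (toℕ (φ j) ≤? p)

  module L (p : ℕ) = Lowering a pos φ (Raised? p) (λ r → ≤-trans (s≤s z≤n) (proj₁ r))
  open L public using (lowered; lowerPt; floorPt)

  unoccupied : ∀ {j} → toℕ (φ j) ≢ z
  unoccupied {j} refl = contradiction zero-z (>⇒≢ (dim-pos φ j))

  dim-lowered-self : ∀ {p} → z < p → dim (lowered p) p ≡ 0
  dim-lowered-self {p} z<p = dim-none (lowered p) vacated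
    where
    vacated : ∀ j → toℕ (lowered p j) ≢ p
    vacated j = by (Raised? p j)
      where
      by : Dec (Raised p j) → toℕ (lowered p j) ≢ p
      by (yes r) ψj≡p = <-irrefl ψj≡p (subst (_≤ p) (sym (L.toℕ-lowered-moved p r)) (proj₂ r))
      by (no ¬r) ψj≡p = ¬r (subst (z <_) (sym φj≡p) z<p , ≤-reflexive φj≡p)
        where
        φj≡p : toℕ (φ j) ≡ p
        φj≡p = trans (cong toℕ (sym (L.lowered-kept p ¬r))) ψj≡p

  iOf-lowered : ∀ {p} → z < p → p < suc n → toℕ (iOf a (lowered p)) ≡ p
  iOf-lowered {p} z<p p≤n = LastBelow-functional (iOf-view a (lowered p)) (found p≤n (dim-lowered-self z<p) occupied)
    where
    occupied : ∀ {k} → p < k → k < suc n → dim (lowered p) k ≢ 0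
    occupied {k} p<k k≤n with dim-∃ φ (n≢0⇒n>0 (nonzero (<-trans z<p p<k) k≤n))
    ... | j , φj≡k = >⇒≢ (subst (λ l → 0 < dim (lowered p) l) ψj≡k (dim-pos (lowered p) j))
      where
      ψj≡k : toℕ (lowered p j) ≡ k
      ψj≡k = trans (cong toℕ (L.lowered-kept p (λ r → <⇒≱ p<k (subst (_≤ p) φj≡k (proj₂ r))))) φj≡k

  bubble-step : ∀ {p} → z ≤ p → p < n → (y : Pt n) → (∀ {j} → toℕ (φ j) ≡ suc p → y j ≡ b j) →
    (∀ {j} → toℕ (φ j) ≢ suc p → y j ≡ lowerPt (suc p) b j) → Step a (lowerPt (suc p) b) (lowered (suc p)) y
  bubble-step {p} z≤p p<n y at-p others j with toℕ (φ j) ≟ suc p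
  ... | no φj≢1+p = subst (StepAt a (lowered (suc p)) j _) (sym (others φj≢1+p)) (stepAt-stay a pos (lowered (suc p)) j _)
  ... | yes φj≡1+p = subst₂ (StepAt a ψ j) (sym (L.lowerPt-moved (suc p) raised)) (sym (at-p φj≡1+p))
                            (stepAt-rise a pos ψ j i≮ψj (proj₁ rise) (subst (λ i → b j ≤ _ + a i j) (sym i≡φj) (proj₂ rise)))
    where
    ψ : CellIx n
    ψ = lowered (suc p)
    raised : Raised (suc p) j
    raised = subst (z <_) (sym φj≡1+p) (s≤s z≤p) , ≤-reflexive φj≡1+p
    toℕ-iOf : toℕ (iOf a ψ) ≡ suc p
    toℕ-iOf = iOf-lowered (s≤s z≤p) (s≤s p<n)
    i≡φj : iOf a ψ ≡ φ j
    i≡φj = toℕ-injective (trans toℕ-iOf (sym φj≡1+p))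
    i≮ψj : ¬ toℕ (iOf a ψ) < toℕ (ψ j)
    i≮ψj = subst₂ (λ u v → ¬ u < v) (sym toℕ-iOf) (sym (suc-injective (trans (L.toℕ-lowered-moved (suc p) raised) φj≡1+p)))
                  (≤⇒≯ (n≤1+n p))
    rise : prefix a (toℕ (φ j)) j ∸ 1 ≤ b j × b j ≤ prefix a (toℕ (φ j)) j ∸ 1 + a (φ j) j
    rise = slab-fromLastBefore a pos (φ j) (subst (0 <_) (sym φj≡1+p) (s≤s z≤n)) (hb j)

  bubble : ∀ {p} → z < p → p < suc n → Reach a (lowerPt p b) b
  bubble {suc p} z<1+p 1+p≤n with m≤n⇒m<n∨m≡n (s≤s⁻¹ z<1+p)
  ... | inj₁ z<p = step (lowered (suc p)) (L.hasType-lowerPt (suc p) hb)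
                        (bubble-step (<⇒≤ z<p) (s≤s⁻¹ 1+p≤n) (lowerPt p b) settled unchanged)
                        (bubble z<p (<-trans (n<1+n p) 1+p≤n))
    where
    settled : ∀ {j} → toℕ (φ j) ≡ suc p → lowerPt p b j ≡ b j
    settled φj≡1+p = L.lowerPt-kept p (λ r → <-irrefl refl (subst (_≤ p) φj≡1+p (proj₂ r)))
    unchanged : ∀ {j} → toℕ (φ j) ≢ suc p → lowerPt p b j ≡ lowerPt (suc p) b j
    unchanged {j} φj≢1+p = by (Raised? p j)
      where
      by : Dec (Raised p j) → lowerPt p b j ≡ lowerPt (suc p) b j
      by (yes r) = trans (L.lowerPt-moved p r) (sym (L.lowerPt-moved (suc p) (proj₁ r , m≤n⇒m≤1+n (proj₂ r))))
      by (no ¬r) = trans (L.lowerPt-kept p ¬r) (sym (L.lowerPt-kept (suc p) λ (z<φj , φj≤1+p) →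
                     ¬r (z<φj , s≤s⁻¹ (≤∧≢⇒< φj≤1+p φj≢1+p))))
  ... | inj₂ refl = step (lowered (suc z)) (L.hasType-lowerPt (suc z) hb)
                         (bubble-step ≤-refl (s≤s⁻¹ 1+p≤n) b (λ _ → refl) λ φj≢1+z →
                           sym (L.lowerPt-kept (suc z) λ (z<φj , φj≤1+z) → φj≢1+z (≤-antisym φj≤1+z z<φj))) done

  data Class (j : Fin n) : Set where
    down : z < toℕ (φ j) → suc (toℕ (lowered n j)) ≡ toℕ (φ j) → Class j
    kept : toℕ (φ j) < z → toℕ (lowered n j) ≡ toℕ (φ j) → Class j

  classify : ∀ j → Class j
  classify j = by (Raised? n j)
    where
    by : Dec (Raised n j) → Class j
    by (yes r) = down (proj₁ r) (L.toℕ-lowered-moved n r)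
    by (no ¬r) = kept (≤∧≢⇒< (≮⇒≥ λ z<φj → ¬r (z<φj , s≤s⁻¹ (toℕ<n (φ j)))) unoccupied) (cong toℕ (L.lowered-kept n ¬r))

  dim-below : ∀ {k} → k < z → dim (lowered n) k ≡ dim φ k
  dim-below {k} k<z = dim-cong (lowered n) φ λ j → by (classify j)
    where
    by : ∀ {j} → Class j → toℕ (lowered n j) ≡ k ⇔ toℕ (φ j) ≡ k
    by (down z<φj moved) = mk⇔ (λ { refl → contradiction (subst (_≤ z) moved k<z) (<⇒≱ z<φj) })
                               (λ { refl → contradiction k<z (<⇒≯ z<φj) })
    by (kept _ same) = mk⇔ (trans (sym same)) (trans same)

  dim-above : ∀ {k} → z ≤ k → dim (lowered n) k ≡ dim φ (suc k)
  dim-above {k} z≤k = dim-cong (lowered n) φ λ j → by (classify j)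
    where
    by : ∀ {j} → Class j → toℕ (lowered n j) ≡ k ⇔ toℕ (φ j) ≡ suc k
    by (down _ moved) = mk⇔ (λ { refl → sym moved }) (λ φj≡1+k → suc-injective (trans moved φj≡1+k))
    by (kept φj<z same) = mk⇔ (λ ψj≡k → contradiction (trans (sym same) ψj≡k) (<⇒≢ (<-≤-trans φj<z z≤k)))
                              (λ φj≡1+k → contradiction (<-trans (subst (_< z) φj≡1+k φj<z) (s≤s z≤k)) (<-irrefl refl))

module LowerIntoGap {n : ℕ} (a : Coeffs n) (pos : ∀ i j → 0 < a i j) (φ : CellIx n)
  {z₂ q₀ : ℕ} (zero-z₂ : dim φ z₂ ≡ 0) (z₂≤q₀ : z₂ ≤ q₀) (j₀ : Fin n) (φj₀ : toℕ (φ j₀) ≡ suc q₀) where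

  Moved : Fin n → Set
  Moved j = (z₂ < toℕ (φ j) × toℕ (φ j) ≤ q₀) ⊎ j ≡ j₀

  Moved? : Decidable Moved
  Moved? j = ((z₂ <? toℕ (φ j)) ×-dec (toℕ (φ j) ≤? q₀)) ⊎-dec (j Fin.≟ j₀)

  moved⇒pos : ∀ {j} → Moved j → 0 < toℕ (φ j)
  moved⇒pos (inj₁ (z₂<φj , _)) = ≤-trans (s≤s z≤n) z₂<φj
  moved⇒pos (inj₂ refl) = subst (0 <_) (sym φj₀) (s≤s z≤n)

  open Lowering a pos φ Moved? moved⇒pos public

  data Class (j : Fin n) : Set where
    between : z₂ < toℕ (φ j) → toℕ (φ j) ≤ q₀ → suc (toℕ (lowered j)) ≡ toℕ (φ j) → Class j
    lent    : j ≡ j₀ → toℕ (lowered j) ≡ q₀ → Class j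
    kept    : j ≢ j₀ → toℕ (φ j) < z₂ ⊎ suc q₀ ≤ toℕ (φ j) → toℕ (lowered j) ≡ toℕ (φ j) → Class j

  classify : ∀ j → Class j
  classify j = by (Moved? j)
    where
    by : Dec (Moved j) → Class j
    by (yes m@(inj₁ (z₂<φj , φj≤q₀))) = between z₂<φj φj≤q₀ (toℕ-lowered-moved m)
    by (yes m@(inj₂ refl)) = lent refl (suc-injective (trans (toℕ-lowered-moved m) φj₀))
    by (no ¬m) = kept (¬m ∘ inj₂) outside (cong toℕ (lowered-kept ¬m))
      where
      outside : toℕ (φ j) < z₂ ⊎ suc q₀ ≤ toℕ (φ j)
      outside with toℕ (φ j) ≤? q₀
      ... | no φj≰q₀ = inj₂ (≰⇒> φj≰q₀)
      ... | yes φj≤q₀ = inj₁ (≤∧≢⇒< (≮⇒≥ λ z₂<φj → ¬m (inj₁ (z₂<φj , φj≤q₀)))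
                                   λ { refl → contradiction zero-z₂ (>⇒≢ (dim-pos φ j)) })

  kept-outside : ∀ {j v} → toℕ (φ j) < z₂ ⊎ suc q₀ ≤ toℕ (φ j) → z₂ ≤ v → v ≤ q₀ → toℕ (φ j) ≢ v
  kept-outside (inj₁ φj<z₂) z₂≤v _ refl = <⇒≱ φj<z₂ z₂≤v
  kept-outside (inj₂ q<φj) _ v≤q₀ refl = <⇒≱ q<φj v≤q₀

  dim-below : ∀ {k} → k < z₂ → dim lowered k ≡ dim φ k
  dim-below {k} k<z₂ = dim-cong lowered φ λ j → by (classify j)
    where
    by : ∀ {j} → Class j → toℕ (lowered j) ≡ k ⇔ toℕ (φ j) ≡ k
    by (between z₂<φj _ moved) = mk⇔ (λ { refl → ⊥-elim (<⇒≱ z₂<φj (subst (_≤ z₂) moved k<z₂)) })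
                                     (λ { refl → ⊥-elim (<⇒≯ z₂<φj k<z₂) })
    by (lent refl ψj≡q₀) = mk⇔ (λ ψj≡k → ⊥-elim (<-irrefl (trans (sym ψj≡k) ψj≡q₀) (<-≤-trans k<z₂ z₂≤q₀)))
                               (λ φj≡k → ⊥-elim (<-irrefl (trans (sym φj≡k) φj₀) (<-≤-trans k<z₂ (m≤n⇒m≤1+n z₂≤q₀))))
    by (kept _ _ same) = mk⇔ (trans (sym same)) (trans same)

  dim-shifted : ∀ {k} → z₂ ≤ k → k < q₀ → dim lowered k ≡ dim φ (suc k)
  dim-shifted {k} z₂≤k k<q₀ = dim-cong lowered φ λ j → by (classify j)
    where
    by : ∀ {j} → Class j → toℕ (lowered j) ≡ k ⇔ toℕ (φ j) ≡ suc k
    by (between _ _ moved) = mk⇔ (λ ψj≡k → trans (sym moved) (cong suc ψj≡k)) (λ φj≡1+k → suc-injective (trans moved φj≡1+k))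
    by (lent refl ψj≡q₀) = mk⇔ (λ ψj≡k → ⊥-elim (<-irrefl (trans (sym ψj≡k) ψj≡q₀) k<q₀))
                               (λ φj≡1+k → ⊥-elim (<-irrefl (suc-injective (trans (sym φj≡1+k) φj₀)) k<q₀))
    by (kept _ outside same) = mk⇔ (λ ψj≡k → contradiction (trans (sym same) ψj≡k) (kept-outside outside z₂≤k (<⇒≤ k<q₀)))
                                   (λ φj≡1+k → contradiction φj≡1+k (kept-outside outside (m≤n⇒m≤1+n z₂≤k) k<q₀))

  dim-lent : dim lowered q₀ ≡ 1
  dim-lent = dim-singleton lowered j₀ λ j → by (classify j)
    where
    by : ∀ {j} → Class j → toℕ (lowered j) ≡ q₀ ⇔ j ≡ j₀
    by (between _ φj≤q₀ moved) = mk⇔ (λ ψj≡q₀ → contradiction (subst (_≤ q₀) (trans (sym moved) (cong suc ψj≡q₀)) φj≤q₀)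
                                                               (<-irrefl refl))
                                     (λ { refl → contradiction (subst (_≤ q₀) φj₀ φj≤q₀) (<-irrefl refl) })
    by (lent j≡j₀ ψj≡q₀) = mk⇔ (λ _ → j≡j₀) (λ _ → ψj≡q₀)
    by (kept j≢j₀ outside same) = mk⇔ (λ ψj≡q₀ → contradiction (trans (sym same) ψj≡q₀) (kept-outside outside z₂≤q₀ ≤-refl))
                                      (λ j≡j₀ → contradiction j≡j₀ j≢j₀)

  dim-lender : suc (dim lowered (suc q₀)) ≡ dim φ (suc q₀)
  dim-lender = dim-remove lowered φ j₀ φj₀ λ j → by (classify j)
    where
    by : ∀ {j} → Class j → toℕ (lowered j) ≡ suc q₀ ⇔ (toℕ (φ j) ≡ suc q₀ × j ≢ j₀)
    by (between _ φj≤q₀ moved) = mk⇔ (λ ψj≡1+q₀ → contradiction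
                                       (≤-trans (n≤1+n _) (subst (_≤ q₀) (trans (sym moved) (cong suc ψj≡1+q₀)) φj≤q₀))
                                       (<-irrefl refl))
                                     (λ (φj≡1+q₀ , _) → contradiction (subst (_≤ q₀) φj≡1+q₀ φj≤q₀) (<-irrefl refl))
    by (lent refl ψj≡q₀) = mk⇔ (λ ψj≡1+q₀ → contradiction (trans (sym ψj≡q₀) ψj≡1+q₀) (<⇒≢ (n<1+n q₀)))
                               (λ (_ , j₀≢j₀) → contradiction refl j₀≢j₀)
    by (kept j≢j₀ _ same) = mk⇔ (λ ψj≡1+q₀ → trans (sym same) ψj≡1+q₀ , j≢j₀) (trans same ∘ proj₁)

  dim-above : ∀ {k} → suc q₀ < k → dim lowered k ≡ dim φ k
  dim-above {k} q<k = dim-cong lowered φ λ j → by (classify j)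
    where
    by : ∀ {j} → Class j → toℕ (lowered j) ≡ k ⇔ toℕ (φ j) ≡ k
    by (between _ φj≤q₀ moved) = mk⇔ (λ { refl → ⊥-elim (<⇒≱ q<k (m≤n⇒m≤1+n (≤-trans (n≤1+n _)
                                                                            (subst (_≤ q₀) (sym moved) φj≤q₀)))) })
                                     (λ { refl → ⊥-elim (<⇒≱ q<k (m≤n⇒m≤1+n φj≤q₀)) })
    by (lent refl ψj≡q₀) = mk⇔ (λ ψj≡k → ⊥-elim (<⇒≱ q<k (subst (_≤ suc q₀) (trans (sym ψj≡q₀) ψj≡k) (n≤1+n q₀))))
                               (λ φj≡k → ⊥-elim (<-irrefl (trans (sym φj₀) φj≡k) q<k))
    by (kept _ _ same) = mk⇔ (trans (sym same)) (trans same)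

  moved≤q : ∀ {j} → Moved j → toℕ (φ j) ≤ suc q₀
  moved≤q (inj₁ (_ , φj≤q₀)) = m≤n⇒m≤1+n φj≤q₀
  moved≤q (inj₂ refl) = ≤-reflexive φj₀

-- The two cases

Predecessor : ∀ {n} → Coeffs n → Pt n → CellIx n → ℕ → Set
Predecessor {n} a b φ K = Σ (Pt n) λ b' → Σ (CellIx n) λ φ' → Σ (Pt n) λ bbar →
  HasType a b' φ' × InG a φ' × gOf a φ' ≡ K × Step a b' φ' bbar × HasType a bbar φ × Reach a b' b

-- I is I_b and z is i(b).
record Analysis {n : ℕ} (a : Coeffs n) (φ : CellIx n) (K I z : ℕ) : Set where
  field
    I<1+n     : I < suc n
    crowded   : 1 < dim φ I
    uncrowded : ∀ {k} → I < k → k < suc n → ¬ 1 < dim φ k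
    zeros     : zerosBelow (dim φ) I ≡ suc K
    z<1+n     : z < suc n
    empty     : dim φ z ≡ 0
    nonempty  : ∀ {k} → z < k → k < suc n → dim φ k ≢ 0

analyse : ∀ {n} (a : Coeffs n) (φ : CellIx n) {K} → gOf a φ ≡ suc K → ∃₂ (Analysis a φ K)
analyse {n} a φ {K} g≡1+K with Ib a φ | Ib-view a φ | gOf-≡ a φ
... | _ | none _ | g≡0 = contradiction (trans (sym g≡1+K) g≡0) λ ()
... | I | found I<1+n crowded uncrowded | g≡zeros with toℕ (iOf a φ) | iOf-view a φ
...   | z | found z<1+n empty nonempty = I , z , record
  { I<1+n = I<1+n ; crowded = crowded ; uncrowded = uncrowded ; zeros = zeros
  ; z<1+n = z<1+n ; empty = empty ; nonempty = nonempty }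
  where
  zeros : zerosBelow (dim φ) I ≡ suc K
  zeros = trans (sym g≡zeros) g≡1+K
...   | _ | none nonempty with sumBelow-∃ I (subst (0 <_) (sym (trans (sym g≡zeros) g≡1+K)) (s≤s z≤n))
...     | k , k<I , isZero>0 = contradiction (isZero⇒≡0 isZero>0) (nonempty (<-trans k<I I<1+n))
  where
  isZero⇒≡0 : ∀ {m} → 0 < isZero m → m ≡ 0
  isZero⇒≡0 {zero} _ = refl

module _ {n : ℕ} (a : Coeffs n) (pos : ∀ i j → 0 < a i j) {b : Pt n} {φ : CellIx n}
  (hb : HasType a b φ) (inG : InG a φ) where

  predecessor-belowTop : ∀ {K I z} → Analysis a φ K I z → z < I → Predecessor a b φ K
  predecessor-belowTop {K} {suc I'} {z} A z<I =
    lowerPt n b , lowered n , floorPt n b ,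
    L.hasType-lowerPt n hb , Equivalence.from (InG⇔Bounded a (lowered n)) D.bounded' , GValue⇒gOf a (lowered n) D.gValue' ,
    L.step-lowerPt-floorPt n hb below , L.hasType-floorPt n hb , bubble z<n (n<1+n n)
    where
    open Analysis A
    open LowerAboveEmpty a pos φ hb empty nonempty
    z<n : z < n
    z<n = <-≤-trans z<I (s≤s⁻¹ I<1+n)
    module D = DropEmptyLevel (dim φ) (dim (lowered n)) (dim-total φ) (Equivalence.to (InG⇔Bounded a φ) inG)
      (s≤s⁻¹ I<1+n) crowded uncrowded zeros empty nonempty (s≤s⁻¹ z<I) dim-below (λ z≤k _ → dim-above z≤k)
      (dim-lowered-self z<n)
    below : ∀ {j} → Raised n j → toℕ (lowered n j) < toℕ (iOf a (lowered n))
    below {j} r = subst (toℕ (lowered n j) <_) (sym (iOf-lowered z<n (n<1+n n)))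
                        (subst (_≤ n) (sym (L.toℕ-lowered-moved n r)) (s≤s⁻¹ (toℕ<n (φ j))))

  module _ {K I z : ℕ} (A : Analysis a φ K I z) (I<z : I < z) where

    open Analysis A

    private
      bounded : Bounded n (dim φ)
      bounded = Equivalence.to (InG⇔Bounded a φ) inG

      toℕ-iOf : toℕ (iOf a φ) ≡ z
      toℕ-iOf = LastBelow-functional (iOf-view a φ) (found z<1+n empty nonempty)

      crowdedBelowTop : ∃ λ q → q ≤ I × 1 < dim φ q × (q < I ⊎ (q ≡ I × ∀ {k} → k < I → ¬ 1 < dim φ k))
      crowdedBelowTop with lastBelow (λ k → 1 <? dim φ k) I I | lastBelow-view (λ k → 1 <? dim φ k) I I
      ... | _ | none below = I , ≤-refl , crowded , inj₂ (refl , below)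
      ... | q | found q<I crowded-q _ = q , <⇒≤ q<I , crowded-q , inj₁ q<I

      emptyBelow : ∀ {q} → q ≤ I → 1 < dim φ q →
        ∃ λ z₂ → z₂ < q × dim φ z₂ ≡ 0 × (∀ {k} → z₂ < k → k < q → dim φ k ≢ 0)
      emptyBelow {q} q≤I crowded-q with lastBelow (λ k → dim φ k ≟ 0) q 0 | lastBelow-view (λ k → dim φ k ≟ 0) q 0
      ... | _ | none nonempty₂ = contradiction (λ {k} → nonempty₂ {k})
                                   (crowded⇒emptyBelow bounded (<-≤-trans (≤-<-trans q≤I I<z) (s≤s⁻¹ z<1+n)) crowded-q)
      ... | z₂ | found z₂<q empty₂ nonempty₂ = z₂ , z₂<q , empty₂ , nonempty₂

      borrow : ∀ {q z₂} → q ≤ I → 1 < dim φ q → q < I ⊎ (q ≡ I × ∀ {k} → k < I → ¬ 1 < dim φ k) →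
        z₂ < q → dim φ z₂ ≡ 0 → (∀ {k} → z₂ < k → k < q → dim φ k ≢ 0) → Predecessor a b φ K
      borrow {suc q₀} {z₂} q≤I crowded-q choice (s≤s z₂≤q₀) empty₂ nonempty₂ =
        lowerPt b , lowered , floorPt b ,
        hasType-lowerPt hb , Equivalence.from (InG⇔Bounded a lowered) B.bounded' , GValue⇒gOf a lowered B.gValue' ,
        step-lowerPt-floorPt hb lowered-below , hasType-floorPt hb ,
        step lowered (hasType-lowerPt hb) (step-lowerPt-floorPt hb lowered-below)
             (walk a pos φ (hasType-floorPt hb) hb (floorPt≤ hb) (floor-below ∘ floorPt<⇒moved hb))
        where
        j₀-at-q : ∃ λ j → toℕ (φ j) ≡ suc q₀
        j₀-at-q = dim-∃ φ (<-trans (s≤s z≤n) crowded-q)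
        open LowerIntoGap a pos φ empty₂ z₂≤q₀ (proj₁ j₀-at-q) (proj₂ j₀-at-q)
        module B = BorrowFromCrowded (dim φ) (dim lowered) (dim-total lowered) bounded I<1+n crowded uncrowded zeros
          z<1+n empty nonempty I<z q≤I crowded-q choice z₂≤q₀ empty₂ nonempty₂
          dim-below dim-shifted dim-lent dim-lender dim-above
        q<z : suc q₀ < z
        q<z = ≤-<-trans q≤I I<z
        lowered-below : ∀ {j} → Moved j → toℕ (lowered j) < toℕ (iOf a lowered)
        lowered-below {j} m = subst (toℕ (lowered j) <_) (sym (LastBelow-functional (iOf-view a lowered) B.lastZero'))
          (<-trans (subst (_≤ suc q₀) (sym (toℕ-lowered-moved m)) (moved≤q m)) q<z)
        floor-below : ∀ {j} → Moved j → toℕ (φ j) < toℕ (iOf a φ)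
        floor-below m = subst (_ <_) (sym toℕ-iOf) (≤-<-trans (moved≤q m) q<z)

    predecessor-aboveTop : Predecessor a b φ K
    predecessor-aboveTop with crowdedBelowTop
    ... | q , q≤I , crowded-q , choice with emptyBelow q≤I crowded-q
    ...   | z₂ , z₂<q , empty₂ , nonempty₂ = borrow q≤I crowded-q choice z₂<q empty₂ nonempty₂

theorem3p13 : (n : ℕ) → 1 ≤ n → (a : Coeffs n) →
    (∀ i j → 0 < a i j) →
    (∀ (i i' : Fin (suc n)) (j : Fin n) → toℕ i ≤ toℕ i' → toℕ i' < n → a i j ≤ a i' j) →
    (b : Pt n) → (φ : CellIx n) → HasType a b φ → InG a φ →
    (K : ℕ) → gOf a φ ≡ suc K →
    Σ (Pt n) (λ b' → Σ (CellIx n) (λ φ' → Σ (Pt n) (λ bbar →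
      HasType a b' φ' × InG a φ' × gOf a φ' ≡ K ×
      Step a b' φ' bbar × HasType a bbar φ × Reach a b' b)))
theorem3p13 n _ a pos _ b φ hb inG K g≡1+K with analyse a φ g≡1+K
... | I , z , A with <-cmp z I
...   | tri< z<I _ _ = predecessor-belowTop a pos hb inG A z<I
...   | tri≈ _ refl _ = contradiction (Analysis.empty A) (>⇒≢ (<-trans (s≤s z≤n) (Analysis.crowded A)))
...   | tri> _ _ I<z = predecessor-aboveTop a pos hb inG A I<z
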